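{- If $N$ is odd, there are no strictly period $2$ sink-type quivers on $N$ nodes. If $N=2r$ is even, then every strictly period $2$ sink-type quiver on $N$ nodes has matrix of the form $$B=\sum_{k=1}^{r}\sum_{j=1}^2 m_{kj}B_{N,2}^{(k,j)}\quad\text{if }4\mid N,\qquad B=\Big(\sum_{k=1}^{r-1}\sum_{j=1}^2 m_{kj}B_{N,2}^{(k,j)}\Big)+m_{r1}B_N^{(r)}\quad\text{if }4\nmid N,$$ where the $m_{kj}$ are nonnegative integers such that, if $4\mid N$, there is at least one $k$ with $1\le k\le r$ and $m_{k1}\ne m_{k2}$, and, if $4\nmid N$, there is at least one $k$ with $1\le k\le r-1$ and $m_{k1}\ne m_{k2}$.
   Context: A quiver on nodes $1,\dots,N$ (no loops, no $2$-cycles) is identified with the skew-symmetric integer matrix $B=(b_{ij})$, $b_{ij}$ = number of arrows $i\to j$ minus number $j\to i$. Mutation at $k$: $\mu_kB=\tilde B$ with $\tilde b_{ij}=-b_{ij}$ if $i=k$ or $j=k$, else $\tilde b_{ij}=b_{ij}+\frac12(|b_{ik}|b_{kj}+b_{ik}|b_{kj}|)$. $\rho$: permutation matrix with $\rho_{i+1,i}=1$ ($1\le i\le N-1$), $\rho_{1,N}=1$. $\tau$: matrix with $\tau_{i+1,i}=1$ ($1\le i\le N-1$), $\tau_{1,N}=-1$, other entries $0$. Node $i$ is a sink if $b_{ij}\le0$ for all $j$. A quiver with matrix $B$ has period $m$ if, with $B(1)=B$ and $B(i+1)=\mu_iB(i)$, one has $B(m+1)=\rho^mB\rho^{ -m}$;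 it is strictly period $2$ if it has period $2$ but not period $1$. It is period $2$ sink-type if it has period $2$, node $1$ is a sink of $B(1)$ and node $2$ is a sink of $B(2)$. For $1\le k\le r$ (with $N=2r$), $R_N^{(k)}$ is the skew-symmetric matrix with $(R_N^{(k)})_{N-k+1,1}=1$, $(R_N^{(k)})_{1,N-k+1}=-1$, others $0$. $B_N^{(r)}=\sum_{i=0}^{r-1}\tau^iR_N^{(r)}\tau^{ -i}$. For $1\le k\le r-1$, $B_{N,2}^{(k,1)}=\sum_{i=0}^{r-1}\tau^{2i}R_N^{(k)}\tau^{ -2i}$; if $4\mid N$, $B_{N,2}^{(r,1)}=\sum_{i=0}^{r/2-1}\tau^{2i}R_N^{(r)}\tau^{ -2i}$; and $B_{N,2}^{(k,2)}=\tau B_{N,2}^{(k,1)}\tau^{ -1}$. -}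

module Defs where

open import Data.Nat as ℕ using (ℕ; zero; suc)
open import Data.Nat.Divisibility using (_∣_)
open import Data.Integer as ℤ using (ℤ; +_; -_; _≤_)
open import Data.Integer.DivMod using (_/_)
open import Data.Fin as Fin using (Fin; zero; suc; toℕ; fromℕ; inject₁)
open import Data.Bool using (if_then_else_; _∨_; _∧_)
open import Data.Product using (_×_; Σ; ∃)
open import Relation.Nullary using (¬_; does)
open import Relation.Binary.PropositionalEquality using (_≡_; _≢_)
open import Function using (_∘_)

-- An N×N integer matrix; node i (1 ≤ i ≤ N) is the index  i-1 : Fin N.
Mat : ℕ → Set
Mat N = Fin N → Fin N → ℤ

_≐_ : ∀ {N} → Mat N → Mat N → Set
A ≐ B = ∀ i j → A i j ≡ B i j

SkewSym : ∀ {N} → Mat N → Set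
SkewSym B = ∀ i j → B i j ≡ - B j i

0M : ∀ {N} → Mat N
0M i j = + 0

_⊕_ : ∀ {N} → Mat N → Mat N → Mat N
(A ⊕ B) i j = A i j ℤ.+ B i j
infixl 6 _⊕_

_·_ : ∀ {N} → ℕ → Mat N → Mat N
(m · B) i j = + m ℤ.* B i j
infixl 7 _·_

sumMat : ∀ {N} → ℕ → (ℕ → Mat N) → Mat N
sumMat zero    f = 0M
sumMat (suc n) f = sumMat n f ⊕ f n

iter : ∀ {A : Set} → ℕ → (A → A) → A → A
iter zero    f x = x
iter (suc n) f x = f (iter n f x)

μ : ∀ {N} → Fin N → Mat N → Mat N
μ k B i j =
  if does (i Fin.≟ k) ∨ does (j Fin.≟ k)
  then - B i j
  else B i j ℤ.+ ((+ ℤ.∣ B i k ∣ ℤ.* B k j ℤ.+ B i k ℤ.* + ℤ.∣ B k j ∣) / + 2)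

cycPred : ∀ {N} → Fin N → Fin N
cycPred {suc n} zero    = fromℕ n
cycPred {suc n} (suc i) = inject₁ i

-- ρ B ρ^{-1}, written out entrywise: ρ is the permutation matrix with
-- ρ e_i = e_{i+1} (indices mod N), so (ρ B ρ^{-1})_{ij} = b_{i-1,j-1}.
conjρ : ∀ {N} → Mat N → Mat N
conjρ B i j = B (cycPred i) (cycPred j)

-- sign ε(i) = τ_{i,i-1}: -1 for node 1, +1 otherwise.
sgn : ∀ {N} → Fin N → ℤ
sgn zero    = - (+ 1)
sgn (suc _) = + 1

-- τ B τ^{-1}, written out entrywise (τ is a signed permutation matrix,
-- τ^{-1} = τ^T):  (τ B τ^{-1})_{ij} = ε(i) ε(j) b_{i-1,j-1}.
conjτ : ∀ {N} → Mat N → Mat N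
conjτ B i j = sgn i ℤ.* sgn j ℤ.* B (cycPred i) (cycPred j)

node1 : ∀ {n} → Fin (suc (suc n))
node1 = zero

node2 : ∀ {n} → Fin (suc (suc n))
node2 = suc zero

Period1 : ∀ {n} → Mat (suc (suc n)) → Set
Period1 B = μ node1 B ≐ conjρ B

Period2 : ∀ {n} → Mat (suc (suc n)) → Set
Period2 B = μ node2 (μ node1 B) ≐ iter 2 conjρ B

StrictlyPeriod2 : ∀ {n} → Mat (suc (suc n)) → Set
StrictlyPeriod2 B = Period2 B × ¬ Period1 B

IsSink : ∀ {N} → Mat N → Fin N → Set
IsSink B k = ∀ j → B k j ≤ + 0

Period2SinkType : ∀ {n} → Mat (suc (suc n)) → Set
Period2SinkType B = Period2 B × IsSink B node1 × IsSink (μ node1 B) node2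

-- R_N^{(k)}: entry +1 at (N-k+1, 1), entry -1 at (1, N-k+1), 0 elsewhere.
-- (node N-k+1 is the index with toℕ = N ∸ k; node 1 has toℕ = 0)
R : ∀ {N} → ℕ → Mat N
R {N} k i j =
  if does (toℕ i ℕ.≟ N ℕ.∸ k) ∧ does (toℕ j ℕ.≟ 0) then + 1
  else if does (toℕ i ℕ.≟ 0) ∧ does (toℕ j ℕ.≟ N ℕ.∸ k) then - (+ 1)
  else + 0

BN : ∀ {N} → ℕ → Mat N
BN r = sumMat r (λ i → iter i conjτ (R r))

-- B_{N,2}^{(k,1)} = Σ_{i=0}^{r-1} τ^{2i} R_N^{(k)} τ^{-2i}     (1 ≤ k ≤ r-1)
B21 : ∀ {N} → (r k : ℕ) → Mat N
B21 r k = sumMat r (λ i → iter (2 ℕ.* i) conjτ (R k))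

-- B_{N,2}^{(r,1)} = Σ_{i=0}^{r/2-1} τ^{2i} R_N^{(r)} τ^{-2i}   (4 ∣ N)
B21top : ∀ {N} → (r : ℕ) → Mat N
B21top r = sumMat (r ℕ./ 2) (λ i → iter (2 ℕ.* i) conjτ (R r))

B22 : ∀ {N} → (r k : ℕ) → Mat N
B22 r k = conjτ (B21 r k)

B22top : ∀ {N} → (r : ℕ) → Mat N
B22top r = conjτ (B21top r)

lowerPart : ∀ {N} → (r : ℕ) → (ℕ → ℕ → ℕ) → Mat N
lowerPart r m =
  sumMat (r ℕ.∸ 1) (λ k′ → let k = suc k′ in m k 1 · B21 r k ⊕ m k 2 · B22 r k)

-- Since node 1 is a sink of B and node 2 a sink of μ₁B, both mutations merely flip the signs of a
-- row and a column, so period 2 turns into τ²Bτ⁻² = B, while τBτ⁻¹ = B implies period 1.  For odd N,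
-- τᴺ = −1 then forces τBτ⁻¹ = B.  For N = 2r, a τ²-invariant matrix is determined by its first column
-- together with that of its τ-conjugate.  For B these columns are nonnegative by the sink conditions,
-- while those of the basis matrices are unit vectors, so taking for m_{kj} the matching entries of B
-- makes the sum agree with B.  If m_{k1} = m_{k2} for all relevant k, this sum is τ-invariant,
-- contradicting strict period 2.

module Submission where

open import Defs
open import Data.Nat using (ℕ; suc; _*_; _≤_; _∸_)
open import Data.Nat.Divisibility using (_∣_)
open import Data.Product using (_×_; ∃; ∃-syntax; _,_)
open import Data.Empty using (⊥)
open import Relation.Nullary using (¬_)
open import Relation.Binary.PropositionalEquality using (_≡_; _≢_)

open import Data.Bool using (if_then_else_)
open import Data.Empty using (⊥-elim)
open import Data.Fin as Fin using (Fin; zero; suc; toℕ)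
import Data.Fin.Properties as FinP
open import Data.Integer as ℤ using (ℤ; +_; -_; -[1+_]; +[1+_])
import Data.Integer.Properties as ℤP
open import Data.Integer.Tactic.RingSolver using (solve-∀)
open import Data.Nat using (zero; _+_; _<_; _<?_; _≤?_; _≟_; z≤n; s≤s)
open import Data.Nat.DivMod using (_/_; _mod_; m*n/n≡m; m<n⇒m%n≡m)
open import Data.Nat.Divisibility using (divides)
import Data.Nat.Properties as ℕP
open import Data.Product using (proj₁; proj₂)
open import Data.Sum using (_⊎_; inj₁; inj₂; [_,_])
open import Level using (0ℓ)
open import Algebra.Properties.AbelianGroup ℤP.+-0-abelianGroup using (∙-cancelʳ)
open import Relation.Binary.Bundles using (Setoid)
open import Relation.Binary.Definitions using (tri<; tri≈; tri>)
import Relation.Binary.Reasoning.Setoid as SetoidReasoning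
open import Relation.Nullary using (does; yes; no)
open import Relation.Nullary.Decidable using (dec-true; dec-false; _×-dec_)
open import Relation.Binary.PropositionalEquality
  using (≢-sym; refl; sym; trans; cong; cong₂; subst; subst₂; module ≡-Reasoning)


+∣i∣≡-i : ∀ {i} → i ℤ.≤ + 0 → + ℤ.∣ i ∣ ≡ - i
+∣i∣≡-i {i} i≤0 = trans (cong +_ (sym (ℤP.∣-i∣≡∣i∣ i))) (ℤP.0≤i⇒+∣i∣≡i (ℤP.neg-mono-≤ i≤0))

i≡-i⇒i≡0 : ∀ {i} → i ≡ - i → i ≡ + 0
i≡-i⇒i≡0 {+ zero}   _  = refl
i≡-i⇒i≡0 {+[1+ _ ]} ()
i≡-i⇒i≡0 { -[1+ _ ]} ()

2*suc : ∀ t → 2 * suc t ≡ suc (suc (2 * t))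
2*suc t = cong suc (ℕP.+-suc t (t + 0))

even-or-odd : ∀ m → ∃[ t ] (m ≡ 2 * t ⊎ m ≡ suc (2 * t))
even-or-odd zero = 0 , inj₁ refl
even-or-odd (suc m) with even-or-odd m
... | t , inj₁ m≡2t  = t , inj₂ (cong suc m≡2t)
... | t , inj₂ m≡2t+1 = suc t , inj₁ (trans (cong suc m≡2t+1) (sym (2*suc t)))

iter-commute : ∀ {A : Set} (f : A → A) k x → iter k f (f x) ≡ f (iter k f x)
iter-commute f zero    x = refl
iter-commute f (suc k) x = cong f (iter-commute f k x)

iter-double : ∀ {A : Set} (f : A → A) s x → iter (2 * s) f x ≡ iter s (λ y → f (f y)) x
iter-double f zero    x = refl
iter-double f (suc s) x rewrite ℕP.+-suc s (s + 0) = cong (λ y → f (f y)) (iter-double f s x)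

module _ {N : ℕ} where

  ≐-refl : {A : Mat N} → A ≐ A
  ≐-refl i j = refl

  ≐-sym : {A A′ : Mat N} → A ≐ A′ → A′ ≐ A
  ≐-sym e i j = sym (e i j)

  ≐-trans : {A A′ A″ : Mat N} → A ≐ A′ → A′ ≐ A″ → A ≐ A″
  ≐-trans e f i j = trans (e i j) (f i j)

  ≐-setoid : Setoid 0ℓ 0ℓ
  ≐-setoid = record
    { Carrier       = Mat N
    ; _≈_           = _≐_
    ; isEquivalence = record { refl = ≐-refl ; sym = ≐-sym ; trans = ≐-trans }
    }

  module ≐-Reasoning = SetoidReasoning ≐-setoid

  ⊕-cong : {A A′ C C′ : Mat N} → A ≐ A′ → C ≐ C′ → (A ⊕ C) ≐ (A′ ⊕ C′)
  ⊕-cong e f i j = cong₂ ℤ._+_ (e i j) (f i j)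

  ·-cong : ∀ m {A A′ : Mat N} → A ≐ A′ → (m · A) ≐ (m · A′)
  ·-cong m e i j = cong (+ m ℤ.*_) (e i j)

  sumMat-cong : ∀ L {f f′ : ℕ → Mat N} → (∀ s → s < L → f s ≐ f′ s) → sumMat L f ≐ sumMat L f′
  sumMat-cong zero    e = ≐-refl
  sumMat-cong (suc L) e = ⊕-cong (sumMat-cong L (λ s s<L → e s (ℕP.m<n⇒m<1+n s<L))) (e L ℕP.≤-refl)

  sumMat-unfoldˡ : ∀ L (f : ℕ → Mat N) → sumMat (suc L) f ≐ (f 0 ⊕ sumMat L (λ s → f (suc s)))
  sumMat-unfoldˡ zero    f i j = trans (ℤP.+-identityˡ (f 0 i j)) (sym (ℤP.+-identityʳ (f 0 i j)))
  sumMat-unfoldˡ (suc L) f i j =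
    trans (cong (ℤ._+ f (suc L) i j) (sumMat-unfoldˡ L f i j)) (ℤP.+-assoc (f 0 i j) _ _)

  sumMat-vanishing : ∀ L (f : ℕ → Mat N) i j → (∀ s → s < L → f s i j ≡ + 0) → sumMat L f i j ≡ + 0
  sumMat-vanishing zero    f i j h = refl
  sumMat-vanishing (suc L) f i j h =
    cong₂ ℤ._+_ (sumMat-vanishing L f i j (λ s s<L → h s (ℕP.m<n⇒m<1+n s<L))) (h L ℕP.≤-refl)

  sumMat-single : ∀ L (f : ℕ → Mat N) i j s₀ → s₀ < L →
                  (∀ s → s < L → s ≢ s₀ → f s i j ≡ + 0) → sumMat L f i j ≡ f s₀ i j
  sumMat-single (suc L) f i j s₀ s₀<1+L h with ℕP.m<1+n⇒m<n∨m≡n s₀<1+L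
  ... | inj₂ refl =
    trans (cong (ℤ._+ f L i j) (sumMat-vanishing L f i j (λ s s<L → h s (ℕP.m<n⇒m<1+n s<L) (ℕP.<⇒≢ s<L))))
          (ℤP.+-identityˡ _)
  ... | inj₁ s₀<L =
    trans (cong₂ ℤ._+_ (sumMat-single L f i j s₀ s₀<L (λ s s<L → h s (ℕP.m<n⇒m<1+n s<L)))
                       (h L ℕP.≤-refl (≢-sym (ℕP.<⇒≢ s₀<L))))
          (ℤP.+-identityʳ _)

  record IsLinear (g : Mat N → Mat N) : Set where
    field
      ≐-resp : ∀ {A A′} → A ≐ A′ → g A ≐ g A′
      0-hom  : g 0M ≐ 0M
      ⊕-hom  : ∀ A A′ → g (A ⊕ A′) ≐ (g A ⊕ g A′)
      ·-hom  : ∀ m A → g (m · A) ≐ (m · g A)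

    iter-fixed : ∀ {A} → g A ≐ A → ∀ t → iter t g A ≐ A
    iter-fixed fixed zero    = ≐-refl
    iter-fixed fixed (suc t) = ≐-trans (≐-resp (iter-fixed fixed t)) fixed

    sumMat-hom : ∀ L f → g (sumMat L f) ≐ sumMat L (λ s → g (f s))
    sumMat-hom zero    f = 0-hom
    sumMat-hom (suc L) f = ≐-trans (⊕-hom (sumMat L f) (f L)) (⊕-cong (sumMat-hom L f) ≐-refl)

    -- g shifts the orbit sum by one step, and the sum over a full period is shift invariant.
    orbitSum-invariant : ∀ L M → iter L g M ≐ M →
                         g (sumMat L (λ s → iter s g M)) ≐ sumMat L (λ s → iter s g M)
    orbitSum-invariant L M period i j =
      ∙-cancelʳ (M i j) _ _ (begin
        g (sumMat L orbit) i j ℤ.+ M i j                   ≡⟨ cong (ℤ._+ M i j) (sumMat-hom L orbit i j) ⟩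
        sumMat L (λ s → orbit (suc s)) i j ℤ.+ orbit 0 i j ≡⟨ ℤP.+-comm _ (orbit 0 i j) ⟩
        orbit 0 i j ℤ.+ sumMat L (λ s → orbit (suc s)) i j ≡⟨ sumMat-unfoldˡ L orbit i j ⟨
        sumMat L orbit i j ℤ.+ orbit L i j                 ≡⟨ cong (ℤ._+_ (sumMat L orbit i j)) (period i j) ⟩
        sumMat L orbit i j ℤ.+ M i j                       ∎)
      where
        open ≡-Reasoning
        orbit : ℕ → Mat N
        orbit s = iter s g M

  ∘-linear : ∀ {f g} → IsLinear f → IsLinear g → IsLinear (λ A → f (g A))
  ∘-linear F G = record
    { ≐-resp = λ e → F.≐-resp (G.≐-resp e)
    ; 0-hom  = ≐-trans (F.≐-resp G.0-hom) F.0-hom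
    ; ⊕-hom  = λ A A′ → ≐-trans (F.≐-resp (G.⊕-hom A A′)) (F.⊕-hom _ _)
    ; ·-hom  = λ m A → ≐-trans (F.≐-resp (G.·-hom m A)) (F.·-hom m _)
    }
    where
      module F = IsLinear F
      module G = IsLinear G

  conjτ-linear : IsLinear (conjτ {N})
  conjτ-linear = record
    { ≐-resp = λ e i j → cong (sgn i ℤ.* sgn j ℤ.*_) (e (cycPred i) (cycPred j))
    ; 0-hom  = λ i j → ℤP.*-zeroʳ (sgn i ℤ.* sgn j)
    ; ⊕-hom  = λ A A′ i j → ℤP.*-distribˡ-+ (sgn i ℤ.* sgn j) _ _
    ; ·-hom  = λ m A i j → commute (sgn i ℤ.* sgn j) (+ m) _
    }
    where
      commute : ∀ (a b x : ℤ) → a ℤ.* (b ℤ.* x) ≡ b ℤ.* (a ℤ.* x)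
      commute = solve-∀

  conjτ²-linear : IsLinear (λ (A : Mat N) → conjτ (conjτ A))
  conjτ²-linear = ∘-linear conjτ-linear conjτ-linear

  conjτ²-fixed⇒even-fixed : ∀ {A : Mat N} → conjτ (conjτ A) ≐ A → ∀ t → iter (2 * t) conjτ A ≐ A
  conjτ²-fixed⇒even-fixed {A} fixed t =
    subst (λ A′ → A′ ≐ A) (sym (iter-double conjτ t A)) (IsLinear.iter-fixed conjτ²-linear fixed t)

  ≡⇒≐ : {A A′ : Mat N} → A ≡ A′ → A ≐ A′
  ≡⇒≐ refl = ≐-refl

  orbitSum-conjτ-invariant : ∀ L M → iter L conjτ M ≐ M →
                             conjτ (sumMat L (λ s → iter s conjτ M)) ≐ sumMat L (λ s → iter s conjτ M)
  orbitSum-conjτ-invariant = IsLinear.orbitSum-invariant conjτ-linear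

  evenOrbitSum-conjτ²-invariant : ∀ L M → iter (2 * L) conjτ M ≐ M →
    conjτ (conjτ (sumMat L (λ s → iter (2 * s) conjτ M))) ≐ sumMat L (λ s → iter (2 * s) conjτ M)
  evenOrbitSum-conjτ²-invariant L M period =
    ≐-trans (conjτ².≐-resp (sumMat-cong L (λ s _ → ≡⇒≐ (iter-double conjτ s M))))
            (≐-trans (conjτ².orbitSum-invariant L M (≐-trans (≡⇒≐ (sym (iter-double conjτ L M))) period))
                     (sumMat-cong L (λ s _ → ≡⇒≐ (sym (iter-double conjτ s M)))))
    where module conjτ² = IsLinear conjτ²-linear

*-neg-swap : ∀ (s t x : ℤ) → s ℤ.* t ℤ.* - x ≡ - (t ℤ.* s ℤ.* x)
*-neg-swap = solve-∀

conjτ-skew : ∀ {N} {A : Mat N} → SkewSym A → SkewSym (conjτ A)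
conjτ-skew skew i j =
  trans (cong (sgn i ℤ.* sgn j ℤ.*_) (skew (cycPred i) (cycPred j))) (*-neg-swap (sgn i) (sgn j) _)

-- Powers of τ

module Rotation (n : ℕ) where

  N : ℕ
  N = suc (suc n)

  cycPredⁿ : ℕ → Fin N → Fin N
  cycPredⁿ k = iter k cycPred

  toℕ-cycPred-suc : ∀ (i : Fin N) {m} → toℕ i ≡ suc m → toℕ (cycPred i) ≡ m
  toℕ-cycPred-suc (suc i) e = trans (FinP.toℕ-inject₁ i) (ℕP.suc-injective e)

  toℕ-cycPred-zero : ∀ (i : Fin N) → toℕ i ≡ 0 → toℕ (cycPred i) ≡ suc n
  toℕ-cycPred-zero zero _ = FinP.toℕ-fromℕ (suc n)

  toℕ-cycPredⁿ-≥ : ∀ k i → k ≤ toℕ i → toℕ (cycPredⁿ k i) + k ≡ toℕ i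
  toℕ-cycPredⁿ-≥ zero    i _ = ℕP.+-identityʳ (toℕ i)
  toℕ-cycPredⁿ-≥ (suc k) i k<i with toℕ (cycPredⁿ k i) in eq | toℕ-cycPredⁿ-≥ k i (ℕP.<⇒≤ k<i)
  ... | zero  | ih = ⊥-elim (ℕP.<-irrefl ih k<i)
  ... | suc m | ih = trans (cong (_+ suc k) (toℕ-cycPred-suc (cycPredⁿ k i) eq)) (trans (ℕP.+-suc m k) ih)

  toℕ-cycPredⁿ-< : ∀ k i → toℕ i < k → k ≤ N → toℕ (cycPredⁿ k i) + k ≡ N + toℕ i
  toℕ-cycPredⁿ-< (suc k) i i<1+k k<N with ℕP.m<1+n⇒m<n∨m≡n i<1+k
  ... | inj₂ i≡k
    rewrite toℕ-cycPred-zero (cycPredⁿ k i)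
              (ℕP.+-cancelʳ-≡ k _ 0 (trans (toℕ-cycPredⁿ-≥ k i (ℕP.≤-reflexive (sym i≡k))) i≡k))
          | i≡k
    = cong suc (ℕP.+-suc n k)
  ... | inj₁ i<k with toℕ (cycPredⁿ k i) in eq | toℕ-cycPredⁿ-< k i i<k (ℕP.<⇒≤ k<N)
  ...   | zero  | ih = ⊥-elim (ℕP.<-irrefl ih (ℕP.<-≤-trans k<N (ℕP.m≤m+n N (toℕ i))))
  ...   | suc m | ih = trans (cong (_+ suc k) (toℕ-cycPred-suc (cycPredⁿ k i) eq)) (trans (ℕP.+-suc m k) ih)

  toℕ-cycPredⁿ-zero : ∀ m → 1 ≤ m → m ≤ N → toℕ (cycPredⁿ m zero) ≡ N ∸ m
  toℕ-cycPredⁿ-zero m 1≤m m≤N =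
    trans (sym (ℕP.m+n∸n≡m (toℕ (cycPredⁿ m zero)) m))
          (cong (_∸ m) (trans (toℕ-cycPredⁿ-< m zero 1≤m m≤N) (ℕP.+-identityʳ N)))

  toℕ-cycPredⁿ-self : ∀ m i → toℕ i ≡ m → toℕ (cycPredⁿ m i) ≡ 0
  toℕ-cycPredⁿ-self m i i≡m =
    ℕP.+-cancelʳ-≡ m _ 0 (trans (toℕ-cycPredⁿ-≥ m i (ℕP.≤-reflexive (sym i≡m))) i≡m)

  toℕ-cycPredⁿ≡0 : ∀ m i → m < N → toℕ (cycPredⁿ m i) ≡ 0 → toℕ i ≡ m
  toℕ-cycPredⁿ≡0 m i m<N ≡0 with m ≤? toℕ i
  ... | yes m≤i = trans (sym (toℕ-cycPredⁿ-≥ m i m≤i)) (cong (_+ m) ≡0)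
  ... | no  m≰i = ⊥-elim (ℕP.<-irrefl refl (ℕP.<-≤-trans m<N (begin
          N                           ≤⟨ ℕP.m≤m+n N (toℕ i) ⟩
          N + toℕ i                   ≡⟨ toℕ-cycPredⁿ-< m i (ℕP.≰⇒> m≰i) (ℕP.<⇒≤ m<N) ⟨
          toℕ (cycPredⁿ m i) + m      ≡⟨ cong (_+ m) ≡0 ⟩
          m                           ∎)))
    where open ℕP.≤-Reasoning

  cycPredᴺ : ∀ i → cycPredⁿ N i ≡ i
  cycPredᴺ i = FinP.toℕ-injective (ℕP.+-cancelʳ-≡ N _ _
    (trans (toℕ-cycPredⁿ-< N i (FinP.toℕ<n i) ℕP.≤-refl) (ℕP.+-comm N (toℕ i))))

  sgnⁿ : ℕ → Fin N → ℤ
  sgnⁿ k i = if does (toℕ i <? k) then - (+ 1) else + 1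

  sgnⁿ-< : ∀ k i → toℕ i < k → sgnⁿ k i ≡ - (+ 1)
  sgnⁿ-< k i i<k rewrite dec-true (toℕ i <? k) i<k = refl

  sgnⁿ-≥ : ∀ k i → ¬ toℕ i < k → sgnⁿ k i ≡ + 1
  sgnⁿ-≥ k i i≮k rewrite dec-false (toℕ i <? k) i≮k = refl

  sgn-sgnⁿ : ∀ k i → suc k ≤ N → sgn i ℤ.* sgnⁿ k (cycPred i) ≡ sgnⁿ (suc k) i
  sgn-sgnⁿ k zero k<N
    rewrite sgnⁿ-≥ k (cycPred zero)
              (ℕP.≤⇒≯ (subst (k ≤_) (sym (toℕ-cycPred-zero zero refl)) (ℕP.≤-pred k<N)))
    = refl
  sgn-sgnⁿ k (suc i) _ with toℕ i <? k
  ... | yes i<k rewrite sgnⁿ-< k (cycPred (suc i)) (subst (_< k) (sym (FinP.toℕ-inject₁ i)) i<k)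
                      | sgnⁿ-< (suc k) (suc i) (s≤s i<k) = refl
  ... | no  i≮k rewrite sgnⁿ-≥ k (cycPred (suc i)) (subst (λ x → ¬ x < k) (sym (FinP.toℕ-inject₁ i)) i≮k)
                      | sgnⁿ-≥ (suc k) (suc i) (λ 1+i<1+k → i≮k (ℕP.≤-pred 1+i<1+k)) = refl

  conjτⁿ : ∀ k (A : Mat N) i j → k ≤ N →
           iter k conjτ A i j ≡ sgnⁿ k i ℤ.* sgnⁿ k j ℤ.* A (cycPredⁿ k i) (cycPredⁿ k j)
  conjτⁿ zero A i j _ = sym (ℤP.*-identityˡ (A i j))
  conjτⁿ (suc k) A i j k<N = begin
    sgn i ℤ.* sgn j ℤ.* iter k conjτ A (cycPred i) (cycPred j)
      ≡⟨ cong (sgn i ℤ.* sgn j ℤ.*_) (conjτⁿ k A (cycPred i) (cycPred j) (ℕP.<⇒≤ k<N)) ⟩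
    sgn i ℤ.* sgn j ℤ.* (sgnⁿ k (cycPred i) ℤ.* sgnⁿ k (cycPred j) ℤ.* a)
      ≡⟨ regroup (sgn i) (sgn j) (sgnⁿ k (cycPred i)) (sgnⁿ k (cycPred j)) a ⟩
    (sgn i ℤ.* sgnⁿ k (cycPred i)) ℤ.* (sgn j ℤ.* sgnⁿ k (cycPred j)) ℤ.* a
      ≡⟨ cong₂ (λ u v → u ℤ.* v ℤ.* a) (sgn-sgnⁿ k i k<N) (sgn-sgnⁿ k j k<N) ⟩
    sgnⁿ (suc k) i ℤ.* sgnⁿ (suc k) j ℤ.* a
      ≡⟨ cong₂ (λ u v → sgnⁿ (suc k) i ℤ.* sgnⁿ (suc k) j ℤ.* A u v)
               (iter-commute cycPred k i) (iter-commute cycPred k j) ⟩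
    sgnⁿ (suc k) i ℤ.* sgnⁿ (suc k) j ℤ.* A (cycPredⁿ (suc k) i) (cycPredⁿ (suc k) j) ∎
    where
      open ≡-Reasoning
      a : ℤ
      a = A (cycPredⁿ k (cycPred i)) (cycPredⁿ k (cycPred j))
      regroup : ∀ (s t u v x : ℤ) → s ℤ.* t ℤ.* (u ℤ.* v ℤ.* x) ≡ (s ℤ.* u) ℤ.* (t ℤ.* v) ℤ.* x
      regroup = solve-∀

  conjτᴺ : ∀ A → iter N conjτ A ≐ A
  conjτᴺ A i j = begin
    iter N conjτ A i j
      ≡⟨ conjτⁿ N A i j ℕP.≤-refl ⟩
    sgnⁿ N i ℤ.* sgnⁿ N j ℤ.* A (cycPredⁿ N i) (cycPredⁿ N j)
      ≡⟨ cong₂ (λ u v → u ℤ.* v ℤ.* A (cycPredⁿ N i) (cycPredⁿ N j))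
               (sgnⁿ-< N i (FinP.toℕ<n i)) (sgnⁿ-< N j (FinP.toℕ<n j)) ⟩
    + 1 ℤ.* A (cycPredⁿ N i) (cycPredⁿ N j)
      ≡⟨ ℤP.*-identityˡ _ ⟩
    A (cycPredⁿ N i) (cycPredⁿ N j)
      ≡⟨ cong₂ A (cycPredᴺ i) (cycPredᴺ j) ⟩
    A i j ∎
    where open ≡-Reasoning

  R-hit₁ : ∀ k (x y : Fin N) → toℕ x ≡ N ∸ k → toℕ y ≡ 0 → R k x y ≡ + 1
  R-hit₁ k x y x≡ y≡ rewrite dec-true ((toℕ x ≟ N ∸ k) ×-dec (toℕ y ≟ 0)) (x≡ , y≡) = refl

  R-hit₂ : ∀ k (x y : Fin N) → toℕ x ≡ 0 → toℕ y ≡ N ∸ k → N ∸ k ≢ 0 → R k x y ≡ - (+ 1)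
  R-hit₂ k x y x≡ y≡ N∸k≢0
    rewrite dec-false ((toℕ x ≟ N ∸ k) ×-dec (toℕ y ≟ 0)) (λ (x≡′ , _) → N∸k≢0 (trans (sym x≡′) x≡))
          | dec-true ((toℕ x ≟ 0) ×-dec (toℕ y ≟ N ∸ k)) (x≡ , y≡) = refl

  R-miss : ∀ k (x y : Fin N) → ¬ (toℕ x ≡ N ∸ k × toℕ y ≡ 0) → ¬ (toℕ x ≡ 0 × toℕ y ≡ N ∸ k) → R k x y ≡ + 0
  R-miss k x y miss₁ miss₂
    rewrite dec-false ((toℕ x ≟ N ∸ k) ×-dec (toℕ y ≟ 0)) miss₁
          | dec-false ((toℕ x ≟ 0) ×-dec (toℕ y ≟ N ∸ k)) miss₂ = refl

  R-col0 : ∀ k (i : Fin N) → toℕ i ≡ N ∸ k → R k i zero ≡ + 1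
  R-col0 k i i≡N∸k = R-hit₁ k i zero i≡N∸k refl

  conjτᵏR-col0 : ∀ k (i : Fin N) → 1 ≤ k → k < N → toℕ i ≡ k → iter k conjτ (R k) i zero ≡ + 1
  conjτᵏR-col0 k i 1≤k k<N i≡k
    rewrite conjτⁿ k (R k) i zero (ℕP.<⇒≤ k<N)
          | sgnⁿ-≥ k i (ℕP.<-irrefl i≡k)
          | sgnⁿ-< k zero 1≤k
          | R-hit₂ k (cycPredⁿ k i) (cycPredⁿ k zero) (toℕ-cycPredⁿ-self k i i≡k)
              (toℕ-cycPredⁿ-zero k 1≤k (ℕP.<⇒≤ k<N)) (λ N∸k≡0 → ℕP.<⇒≱ k<N (ℕP.m∸n≡0⇒m≤n N∸k≡0))
    = refl

  -- Column 0 of τᵐ R_k τ⁻ᵐ (m < N) is e_{N-k} for m = 0, e_k for m = k, and 0 otherwise.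
  conjτᵐR-col0-vanishes : ∀ m k (i : Fin N) → m < N → k < N →
                          ¬ (m ≡ 0 × toℕ i ≡ N ∸ k) → ¬ (toℕ i ≡ m × m ≡ k) →
                          iter m conjτ (R k) i zero ≡ + 0
  conjτᵐR-col0-vanishes zero k i _ k<N notBase _ =
    R-miss k i zero (λ (i≡N∸k , _) → notBase (refl , i≡N∸k))
                    (λ (_ , 0≡N∸k) → ℕP.<⇒≱ k<N (ℕP.m∸n≡0⇒m≤n (sym 0≡N∸k)))
  conjτᵐR-col0-vanishes m@(suc _) k i m<N k<N _ notShift = begin
    iter m conjτ (R k) i zero
      ≡⟨ conjτⁿ m (R k) i zero (ℕP.<⇒≤ m<N) ⟩
    sgnⁿ m i ℤ.* sgnⁿ m zero ℤ.* R k (cycPredⁿ m i) (cycPredⁿ m zero)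
      ≡⟨ cong (sgnⁿ m i ℤ.* sgnⁿ m zero ℤ.*_) (R-miss k (cycPredⁿ m i) (cycPredⁿ m zero) miss₁ miss₂) ⟩
    sgnⁿ m i ℤ.* sgnⁿ m zero ℤ.* + 0
      ≡⟨ ℤP.*-zeroʳ (sgnⁿ m i ℤ.* sgnⁿ m zero) ⟩
    + 0 ∎
    where
      open ≡-Reasoning
      col≡N∸m : toℕ (cycPredⁿ m zero) ≡ N ∸ m
      col≡N∸m = toℕ-cycPredⁿ-zero m (s≤s z≤n) (ℕP.<⇒≤ m<N)
      miss₁ : ¬ (toℕ (cycPredⁿ m i) ≡ N ∸ k × toℕ (cycPredⁿ m zero) ≡ 0)
      miss₁ (_ , col≡0) = ℕP.<⇒≱ m<N (ℕP.m∸n≡0⇒m≤n (trans (sym col≡N∸m) col≡0))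
      miss₂ : ¬ (toℕ (cycPredⁿ m i) ≡ 0 × toℕ (cycPredⁿ m zero) ≡ N ∸ k)
      miss₂ (row≡0 , col≡N∸k) =
        notShift (toℕ-cycPredⁿ≡0 m i m<N row≡0 ,
                  ℕP.∸-cancelˡ-≡ (ℕP.<⇒≤ m<N) (ℕP.<⇒≤ k<N) (trans (sym col≡N∸m) col≡N∸k))

  conjτᵏ-col0 : ∀ k (A : Mat N) → SkewSym A → 1 ≤ k → k < N →
               ∀ i y → toℕ i ≡ k → toℕ y ≡ N ∸ k → iter k conjτ A i zero ≡ A y zero
  conjτᵏ-col0 k A skew 1≤k k<N i y i≡k y≡N∸k = begin
    iter k conjτ A i zero
      ≡⟨ conjτⁿ k A i zero (ℕP.<⇒≤ k<N) ⟩
    sgnⁿ k i ℤ.* sgnⁿ k zero ℤ.* A (cycPredⁿ k i) (cycPredⁿ k zero)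
      ≡⟨ cong₂ (λ s t → s ℤ.* t ℤ.* A (cycPredⁿ k i) (cycPredⁿ k zero))
               (sgnⁿ-≥ k i (ℕP.<-irrefl i≡k)) (sgnⁿ-< k zero 1≤k) ⟩
    - (+ 1) ℤ.* A (cycPredⁿ k i) (cycPredⁿ k zero)
      ≡⟨ cong₂ (λ x z → - (+ 1) ℤ.* A x z)
               (FinP.toℕ-injective (toℕ-cycPredⁿ-self k i i≡k))
               (FinP.toℕ-injective (trans (toℕ-cycPredⁿ-zero k 1≤k (ℕP.<⇒≤ k<N)) (sym y≡N∸k))) ⟩
    - (+ 1) ℤ.* A zero y
      ≡⟨ ℤP.-1*i≡-i (A zero y) ⟩
    - A zero y
      ≡⟨ skew y zero ⟨
    A y zero ∎
    where open ≡-Reasoning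

  -- Column j+2 of a τ²-invariant matrix is read off column j, and column 1 off column 0 of τA.
  τ²-invariant-unique : ∀ {A A′ : Mat N} → conjτ (conjτ A) ≐ A → conjτ (conjτ A′) ≐ A′ →
                        (∀ i → A i zero ≡ A′ i zero) → (∀ i → conjτ A i zero ≡ conjτ A′ i zero) →
                        A ≐ A′
  τ²-invariant-unique {A} {A′} inv inv′ col₀ τcol₀ i j = column (suc (toℕ j)) j ℕP.≤-refl i
    where
      column : ∀ bound j → toℕ j < bound → ∀ i → A i j ≡ A′ i j
      column (suc b) zero          _ i = col₀ i
      column (suc b) (suc zero)    _ i =
        trans (sym (inv i (suc zero)))
              (trans (cong (sgn i ℤ.* + 1 ℤ.*_) (τcol₀ (cycPred i))) (inv′ i (suc zero)))
      column (suc b) (suc (suc j)) j<b i =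
        trans (sym (inv i j+2))
              (trans (cong (λ x → sgn i ℤ.* sgn j+2 ℤ.* (sgn (cycPred i) ℤ.* sgn (cycPred j+2) ℤ.* x))
                           (column b (cycPred (cycPred j+2)) j<b′ (cycPred (cycPred i))))
                     (inv′ i j+2))
        where
          j+2 : Fin N
          j+2 = suc (suc j)
          j<b′ : toℕ (cycPred (cycPred j+2)) < b
          j<b′ = subst (_< b) (sym (trans (FinP.toℕ-inject₁ (Fin.inject₁ j)) (FinP.toℕ-inject₁ j)))
                       (ℕP.<-trans (ℕP.n<1+n _) (ℕP.≤-pred j<b))

-- Mutation at a sink

flipSign : ∀ {N} → Fin N → Fin N → ℤ
flipSign k i = if does (i Fin.≟ k) then - (+ 1) else + 1

-- At a sink b_ik ≥ 0 ≥ b_kj, so the correction term of the mutation rule vanishes.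
μ-at-sink : ∀ {N} (k : Fin N) (A : Mat N) → SkewSym A → IsSink A k →
            ∀ i j → μ k A i j ≡ flipSign k i ℤ.* flipSign k j ℤ.* A i j
μ-at-sink k A skew sink i j with i Fin.≟ k | j Fin.≟ k
... | yes refl | yes refl rewrite i≡-i⇒i≡0 (skew i i) = refl
... | yes refl | no _     = sym (ℤP.-1*i≡-i (A i j))
... | no _     | yes refl = trans (sym (ℤP.-1*i≡-i (A i j))) (cong (ℤ._* A i j) (ℤP.*-identityˡ (- (+ 1))))
... | no _     | no _     = begin
  A i j ℤ.+ ((+ ℤ.∣ A i k ∣ ℤ.* A k j ℤ.+ A i k ℤ.* + ℤ.∣ A k j ∣) ℤ./ + 2)
    ≡⟨ cong (λ c → A i j ℤ.+ (c ℤ./ + 2)) correction≡0 ⟩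
  A i j ℤ.+ + 0
    ≡⟨ ℤP.+-identityʳ (A i j) ⟩
  A i j
    ≡⟨ ℤP.*-identityˡ (A i j) ⟨
  + 1 ℤ.* + 1 ℤ.* A i j ∎
  where
    open ≡-Reasoning
    A-ik≥0 : + 0 ℤ.≤ A i k
    A-ik≥0 = subst (+ 0 ℤ.≤_) (sym (skew i k)) (ℤP.neg-mono-≤ (sink i))
    correction≡0 : + ℤ.∣ A i k ∣ ℤ.* A k j ℤ.+ A i k ℤ.* + ℤ.∣ A k j ∣ ≡ + 0
    correction≡0 = begin
      + ℤ.∣ A i k ∣ ℤ.* A k j ℤ.+ A i k ℤ.* + ℤ.∣ A k j ∣
        ≡⟨ cong₂ (λ u v → u ℤ.* A k j ℤ.+ A i k ℤ.* v) (ℤP.0≤i⇒+∣i∣≡i A-ik≥0) (+∣i∣≡-i (sink j)) ⟩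
      A i k ℤ.* A k j ℤ.+ A i k ℤ.* - A k j
        ≡⟨ cancel (A i k) (A k j) ⟩
      + 0 ∎
      where
        cancel : ∀ (x y : ℤ) → x ℤ.* y ℤ.+ x ℤ.* - y ≡ + 0
        cancel = solve-∀

sgn² : ∀ {N} (i : Fin N) → sgn i ℤ.* sgn i ≡ + 1
sgn² zero    = refl
sgn² (suc i) = refl

flipSign-node1 : ∀ {n} (i : Fin (suc (suc n))) → flipSign node1 i ≡ sgn i
flipSign-node1 zero    = refl
flipSign-node1 (suc i) = refl

sgn-cycPred : ∀ {n} (i : Fin (suc (suc n))) → sgn (cycPred i) ≡ flipSign node2 i
sgn-cycPred zero          = refl
sgn-cycPred (suc zero)    = refl
sgn-cycPred (suc (suc i)) = refl

module Period2Sink {n : ℕ} (B : Mat (suc (suc n))) (skew : SkewSym B) (sinkType : Period2SinkType B) where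

  period2 : Period2 B
  period2 = proj₁ sinkType

  sink₁ : IsSink B node1
  sink₁ = proj₁ (proj₂ sinkType)

  sink₂ : IsSink (μ node1 B) node2
  sink₂ = proj₂ (proj₂ sinkType)

  μ₁-sign : ∀ i j → μ node1 B i j ≡ sgn i ℤ.* sgn j ℤ.* B i j
  μ₁-sign i j = trans (μ-at-sink node1 B skew sink₁ i j)
                      (cong₂ (λ u v → u ℤ.* v ℤ.* B i j) (flipSign-node1 i) (flipSign-node1 j))

  μ₁-skew : SkewSym (μ node1 B)
  μ₁-skew i j = begin
    μ node1 B i j                     ≡⟨ μ₁-sign i j ⟩
    sgn i ℤ.* sgn j ℤ.* B i j         ≡⟨ cong (sgn i ℤ.* sgn j ℤ.*_) (skew i j) ⟩
    sgn i ℤ.* sgn j ℤ.* - B j i       ≡⟨ *-neg-swap (sgn i) (sgn j) (B j i) ⟩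
    - (sgn j ℤ.* sgn i ℤ.* B j i)     ≡⟨ cong -_ (μ₁-sign j i) ⟨
    - μ node1 B j i                   ∎
    where open ≡-Reasoning

  μ₂μ₁-sign : ∀ i j → μ node2 (μ node1 B) i j ≡
               sgn (cycPred i) ℤ.* sgn (cycPred j) ℤ.* (sgn i ℤ.* sgn j ℤ.* B i j)
  μ₂μ₁-sign i j = begin
    μ node2 (μ node1 B) i j
      ≡⟨ μ-at-sink node2 (μ node1 B) μ₁-skew sink₂ i j ⟩
    flipSign node2 i ℤ.* flipSign node2 j ℤ.* μ node1 B i j
      ≡⟨ cong₂ (λ u v → u ℤ.* v ℤ.* μ node1 B i j) (sgn-cycPred i) (sgn-cycPred j) ⟨
    sgn (cycPred i) ℤ.* sgn (cycPred j) ℤ.* μ node1 B i j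
      ≡⟨ cong (sgn (cycPred i) ℤ.* sgn (cycPred j) ℤ.*_) (μ₁-sign i j) ⟩
    sgn (cycPred i) ℤ.* sgn (cycPred j) ℤ.* (sgn i ℤ.* sgn j ℤ.* B i j) ∎
    where open ≡-Reasoning

  conjτ²-invariant : conjτ (conjτ B) ≐ B
  conjτ²-invariant i j = begin
    s ℤ.* t ℤ.* (u ℤ.* v ℤ.* B (cycPred (cycPred i)) (cycPred (cycPred j)))
      ≡⟨ cong (λ x → s ℤ.* t ℤ.* (u ℤ.* v ℤ.* x)) (sym (period2 i j)) ⟩
    s ℤ.* t ℤ.* (u ℤ.* v ℤ.* μ node2 (μ node1 B) i j)
      ≡⟨ cong (λ x → s ℤ.* t ℤ.* (u ℤ.* v ℤ.* x)) (μ₂μ₁-sign i j) ⟩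
    s ℤ.* t ℤ.* (u ℤ.* v ℤ.* (u ℤ.* v ℤ.* (s ℤ.* t ℤ.* B i j)))
      ≡⟨ squares s t u v (B i j) ⟩
    (s ℤ.* s) ℤ.* (t ℤ.* t) ℤ.* ((u ℤ.* u) ℤ.* (v ℤ.* v)) ℤ.* B i j
      ≡⟨ cong₂ (λ x y → x ℤ.* y ℤ.* B i j)
               (cong₂ ℤ._*_ (sgn² i) (sgn² j)) (cong₂ ℤ._*_ (sgn² (cycPred i)) (sgn² (cycPred j))) ⟩
    + 1 ℤ.* + 1 ℤ.* B i j
      ≡⟨ ℤP.*-identityˡ (B i j) ⟩
    B i j ∎
    where
      open ≡-Reasoning
      s t u v : ℤ
      s = sgn i
      t = sgn j
      u = sgn (cycPred i)
      v = sgn (cycPred j)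
      squares : ∀ (s t u v x : ℤ) →
                s ℤ.* t ℤ.* (u ℤ.* v ℤ.* (u ℤ.* v ℤ.* (s ℤ.* t ℤ.* x))) ≡
                (s ℤ.* s) ℤ.* (t ℤ.* t) ℤ.* ((u ℤ.* u) ℤ.* (v ℤ.* v)) ℤ.* x
      squares = solve-∀

  conjτ-invariant⇒period1 : conjτ B ≐ B → Period1 B
  conjτ-invariant⇒period1 invariant i j = begin
    μ node1 B i j
      ≡⟨ μ₁-sign i j ⟩
    sgn i ℤ.* sgn j ℤ.* B i j
      ≡⟨ cong (sgn i ℤ.* sgn j ℤ.*_) (sym (invariant i j)) ⟩
    sgn i ℤ.* sgn j ℤ.* (sgn i ℤ.* sgn j ℤ.* B (cycPred i) (cycPred j))
      ≡⟨ squares (sgn i) (sgn j) _ ⟩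
    (sgn i ℤ.* sgn i) ℤ.* (sgn j ℤ.* sgn j) ℤ.* B (cycPred i) (cycPred j)
      ≡⟨ cong₂ (λ x y → x ℤ.* y ℤ.* B (cycPred i) (cycPred j)) (sgn² i) (sgn² j) ⟩
    + 1 ℤ.* + 1 ℤ.* B (cycPred i) (cycPred j)
      ≡⟨ ℤP.*-identityˡ _ ⟩
    conjρ B i j ∎
    where
      open ≡-Reasoning
      squares : ∀ (s t x : ℤ) → s ℤ.* t ℤ.* (s ℤ.* t ℤ.* x) ≡ (s ℤ.* s) ℤ.* (t ℤ.* t) ℤ.* x
      squares = solve-∀

-- τ² and τᴺ = τ^(2r+1) both fix B, hence so does τ.
no-odd-strictlyPeriod2SinkType : ∀ n r → suc (suc n) ≡ suc (2 * r) →
  (B : Mat (suc (suc n))) → SkewSym B → StrictlyPeriod2 B → Period2SinkType B → ⊥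
no-odd-strictlyPeriod2SinkType n r N≡2r+1 B skew (_ , notPeriod1) sinkType =
  notPeriod1 (conjτ-invariant⇒period1 conjτ-invariant)
  where
    open Rotation n
    open Period2Sink B skew sinkType
    conjτ-invariant : conjτ B ≐ B
    conjτ-invariant =
      ≐-trans (IsLinear.≐-resp conjτ-linear (≐-sym (conjτᴺ B)))
              (subst (λ m → iter m conjτ B ≐ B) (sym (trans (cong suc N≡2r+1) (sym (2*suc r))))
                     (conjτ²-fixed⇒even-fixed conjτ²-invariant (suc r)))

-- Column 0 of the basis matrices

module Basis (n r : ℕ) (N≡2r : suc (suc n) ≡ 2 * r) where
  open Rotation n

  N≡r+r : N ≡ r + r
  N≡r+r = trans N≡2r (cong (_+_ r) (ℕP.+-identityʳ r))

  1≤r : 1 ≤ r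
  1≤r = ℕP.n≢0⇒n>0 (λ r≡0 → ℕP.1+n≢0 (trans N≡2r (cong (2 *_) r≡0)))

  r<N : r < N
  r<N = subst (r <_) (sym N≡r+r) (ℕP.m<m+n r 1≤r)

  k<N : ∀ {k} → k < r → k < N
  k<N k<r = ℕP.<-trans k<r r<N

  N∸r≡r : N ∸ r ≡ r
  N∸r≡r = trans (cong (_∸ r) N≡r+r) (ℕP.m+n∸n≡m r r)

  r<N∸k : ∀ {k} → k < r → r < N ∸ k
  r<N∸k {k} k<r = subst (r <_) (sym (trans (cong (_∸ k) N≡r+r) (ℕP.+-∸-assoc r (ℕP.<⇒≤ k<r))))
                        (ℕP.m<m+n r (ℕP.m<n⇒0<n∸m k<r))

  2s<N : ∀ {s} → s < r → 2 * s < N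
  2s<N {s} s<r = subst (2 * s <_) (sym N≡2r) (ℕP.*-monoʳ-< 2 s<r)

  2s+1<N : ∀ {s} → s < r → suc (2 * s) < N
  2s+1<N {s} s<r = subst (suc (2 * s) <_) (sym N≡2r) (subst (_≤ 2 * r) (2*suc s) (ℕP.*-monoʳ-≤ 2 s<r))

  toℕ-cycPredʳ-zero : ∀ x → toℕ x ≡ 0 → toℕ (cycPredⁿ r x) ≡ r
  toℕ-cycPredʳ-zero x x≡0 rewrite FinP.toℕ-injective {i = x} {j = zero} x≡0 =
    trans (toℕ-cycPredⁿ-zero r 1≤r (ℕP.<⇒≤ r<N)) N∸r≡r

  toℕ-cycPredʳ≡r : ∀ x → toℕ (cycPredⁿ r x) ≡ r → toℕ x ≡ 0
  toℕ-cycPredʳ≡r x πx≡r with r ≤? toℕ x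
  ... | yes r≤x = ⊥-elim (ℕP.<-irrefl N≡x (FinP.toℕ<n x))
    where
      N≡x : toℕ x ≡ N
      N≡x = trans (sym (toℕ-cycPredⁿ-≥ r x r≤x)) (trans (cong (_+ r) πx≡r) (sym N≡r+r))
  ... | no  r≰x = sym (ℕP.+-cancelˡ-≡ N 0 (toℕ x) (begin
          N + 0                      ≡⟨ ℕP.+-identityʳ N ⟩
          N                          ≡⟨ N≡r+r ⟩
          r + r                      ≡⟨ cong (_+ r) πx≡r ⟨
          toℕ (cycPredⁿ r x) + r     ≡⟨ toℕ-cycPredⁿ-< r x (ℕP.≰⇒> r≰x) (ℕP.<⇒≤ r<N) ⟩
          N + toℕ x                  ∎))
    where open ≡-Reasoning

  N∸r≢0 : N ∸ r ≢ 0
  N∸r≢0 N∸r≡0 = ℕP.<⇒≱ r<N (ℕP.m∸n≡0⇒m≤n N∸r≡0)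

  -- τʳ swaps nodes 1 and r+1, which carry the only nonzero entries of R_N^{(r)}.
  conjτʳR-fixed : iter r conjτ (R r) ≐ R r
  conjτʳR-fixed i j with (toℕ i ≟ 0) ×-dec (toℕ j ≟ r) | (toℕ i ≟ r) ×-dec (toℕ j ≟ 0)
  ... | yes (i≡0 , j≡r) | _ = begin
    iter r conjτ (R r) i j
      ≡⟨ conjτⁿ r (R r) i j (ℕP.<⇒≤ r<N) ⟩
    sgnⁿ r i ℤ.* sgnⁿ r j ℤ.* R r (cycPredⁿ r i) (cycPredⁿ r j)
      ≡⟨ cong₂ (λ s t → s ℤ.* t ℤ.* R r (cycPredⁿ r i) (cycPredⁿ r j))
               (sgnⁿ-< r i (subst (_< r) (sym i≡0) 1≤r)) (sgnⁿ-≥ r j (ℕP.<-irrefl j≡r)) ⟩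
    - (+ 1) ℤ.* + 1 ℤ.* R r (cycPredⁿ r i) (cycPredⁿ r j)
      ≡⟨ cong (- (+ 1) ℤ.* + 1 ℤ.*_)
              (R-hit₁ r _ _ (trans (toℕ-cycPredʳ-zero i i≡0) (sym N∸r≡r)) (toℕ-cycPredⁿ-self r j j≡r)) ⟩
    - (+ 1)
      ≡⟨ R-hit₂ r i j i≡0 (trans j≡r (sym N∸r≡r)) N∸r≢0 ⟨
    R r i j ∎
    where open ≡-Reasoning
  ... | no _ | yes (i≡r , j≡0) = begin
    iter r conjτ (R r) i j
      ≡⟨ conjτⁿ r (R r) i j (ℕP.<⇒≤ r<N) ⟩
    sgnⁿ r i ℤ.* sgnⁿ r j ℤ.* R r (cycPredⁿ r i) (cycPredⁿ r j)
      ≡⟨ cong₂ (λ s t → s ℤ.* t ℤ.* R r (cycPredⁿ r i) (cycPredⁿ r j))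
               (sgnⁿ-≥ r i (ℕP.<-irrefl i≡r)) (sgnⁿ-< r j (subst (_< r) (sym j≡0) 1≤r)) ⟩
    + 1 ℤ.* - (+ 1) ℤ.* R r (cycPredⁿ r i) (cycPredⁿ r j)
      ≡⟨ cong (+ 1 ℤ.* - (+ 1) ℤ.*_)
              (R-hit₂ r _ _ (toℕ-cycPredⁿ-self r i i≡r) (trans (toℕ-cycPredʳ-zero j j≡0) (sym N∸r≡r)) N∸r≢0) ⟩
    + 1
      ≡⟨ R-hit₁ r i j (trans i≡r (sym N∸r≡r)) j≡0 ⟨
    R r i j ∎
    where open ≡-Reasoning
  ... | no ¬0r | no ¬r0 = begin
    iter r conjτ (R r) i j
      ≡⟨ conjτⁿ r (R r) i j (ℕP.<⇒≤ r<N) ⟩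
    sgnⁿ r i ℤ.* sgnⁿ r j ℤ.* R r (cycPredⁿ r i) (cycPredⁿ r j)
      ≡⟨ cong (sgnⁿ r i ℤ.* sgnⁿ r j ℤ.*_) (R-miss r _ _ miss₁ miss₂) ⟩
    sgnⁿ r i ℤ.* sgnⁿ r j ℤ.* + 0
      ≡⟨ ℤP.*-zeroʳ (sgnⁿ r i ℤ.* sgnⁿ r j) ⟩
    + 0
      ≡⟨ R-miss r i j (λ (i≡ , j≡0) → ¬r0 (trans i≡ N∸r≡r , j≡0)) (λ (i≡0 , j≡) → ¬0r (i≡0 , trans j≡ N∸r≡r)) ⟨
    R r i j ∎
    where
      open ≡-Reasoning
      miss₁ : ¬ (toℕ (cycPredⁿ r i) ≡ N ∸ r × toℕ (cycPredⁿ r j) ≡ 0)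
      miss₁ (πi≡ , πj≡0) = ¬0r (toℕ-cycPredʳ≡r i (trans πi≡ N∸r≡r) , toℕ-cycPredⁿ≡0 r j r<N πj≡0)
      miss₂ : ¬ (toℕ (cycPredⁿ r i) ≡ 0 × toℕ (cycPredⁿ r j) ≡ N ∸ r)
      miss₂ (πi≡0 , πj≡) = ¬r0 (toℕ-cycPredⁿ≡0 r i r<N πi≡0 , toℕ-cycPredʳ≡r j (trans πj≡ N∸r≡r))

  k<N∸k : ∀ {k} → k < r → k < N ∸ k
  k<N∸k k<r = ℕP.<-trans k<r (r<N∸k k<r)

  2*s≡0⇒s≡0 : ∀ {s} → 2 * s ≡ 0 → s ≡ 0
  2*s≡0⇒s≡0 {zero} _ = refl

  B22-unfold : ∀ k (i : Fin N) → B22 r k i zero ≡ sumMat r (λ s → iter (suc (2 * s)) conjτ (R k)) i zero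
  B22-unfold k i = IsLinear.sumMat-hom conjτ-linear r (λ s → iter (2 * s) conjτ (R k)) i zero

  B21-col0-vanishes : ∀ k (i : Fin N) → k < r → toℕ i ≢ k → toℕ i ≢ N ∸ k → B21 r k i zero ≡ + 0
  B21-col0-vanishes k i k<r i≢k i≢N∸k = sumMat-vanishing r _ i zero λ s s<r →
    conjτᵐR-col0-vanishes (2 * s) k i (2s<N s<r) (k<N k<r)
      (λ (_ , i≡N∸k) → i≢N∸k i≡N∸k) (λ (i≡2s , 2s≡k) → i≢k (trans i≡2s 2s≡k))

  B21-col0-high : ∀ k (i : Fin N) → k < r → toℕ i ≡ N ∸ k → B21 r k i zero ≡ + 1
  B21-col0-high k i k<r i≡N∸k =
    trans (sumMat-single r _ i zero 0 1≤r λ s s<r s≢0 →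
             conjτᵐR-col0-vanishes (2 * s) k i (2s<N s<r) (k<N k<r)
               (λ (2s≡0 , _) → s≢0 (2*s≡0⇒s≡0 2s≡0))
               (λ (i≡2s , 2s≡k) → ℕP.<-irrefl (trans (sym (trans i≡2s 2s≡k)) i≡N∸k) (k<N∸k k<r)))
          (R-col0 k i i≡N∸k)

  B21-col0-even : ∀ k t (i : Fin N) → 1 ≤ k → k < r → k ≡ 2 * t → toℕ i ≡ k → B21 r k i zero ≡ + 1
  B21-col0-even k t i 1≤k k<r k≡2t i≡k =
    trans (sumMat-single r _ i zero t t<r λ s s<r s≢t →
             conjτᵐR-col0-vanishes (2 * s) k i (2s<N s<r) (k<N k<r)
               (λ (_ , i≡N∸k) → ℕP.<-irrefl (trans (sym i≡k) i≡N∸k) (k<N∸k k<r))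
               (λ (_ , 2s≡k) → s≢t (ℕP.*-cancelˡ-≡ s t 2 (trans 2s≡k k≡2t))))
          (subst (λ m → iter m conjτ (R k) i zero ≡ + 1) k≡2t (conjτᵏR-col0 k i 1≤k (k<N k<r) i≡k))
    where
      t<r : t < r
      t<r = ℕP.≤-<-trans (ℕP.m≤m+n t (t + 0)) (subst (_< r) k≡2t k<r)

  B21-col0-odd : ∀ k t (i : Fin N) → k < r → k ≡ suc (2 * t) → toℕ i ≡ k → B21 r k i zero ≡ + 0
  B21-col0-odd k t i k<r k≡2t+1 i≡k = sumMat-vanishing r _ i zero λ s s<r →
    conjτᵐR-col0-vanishes (2 * s) k i (2s<N s<r) (k<N k<r)
      (λ (_ , i≡N∸k) → ℕP.<-irrefl (trans (sym i≡k) i≡N∸k) (k<N∸k k<r))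
      (λ (_ , 2s≡k) → ℕP.even≢odd s t (trans 2s≡k k≡2t+1))

  B22-col0-vanishes : ∀ k (i : Fin N) → k < r → toℕ i ≢ k → B22 r k i zero ≡ + 0
  B22-col0-vanishes k i k<r i≢k = trans (B22-unfold k i) (sumMat-vanishing r _ i zero λ s s<r →
    conjτᵐR-col0-vanishes (suc (2 * s)) k i (2s+1<N s<r) (k<N k<r)
      (λ ()) (λ (i≡2s+1 , 2s+1≡k) → i≢k (trans i≡2s+1 2s+1≡k)))

  B22-col0-even : ∀ k t (i : Fin N) → k < r → k ≡ 2 * t → B22 r k i zero ≡ + 0
  B22-col0-even k t i k<r k≡2t = trans (B22-unfold k i) (sumMat-vanishing r _ i zero λ s s<r →
    conjτᵐR-col0-vanishes (suc (2 * s)) k i (2s+1<N s<r) (k<N k<r)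
      (λ ()) (λ (_ , 2s+1≡k) → ℕP.even≢odd t s (sym (trans 2s+1≡k k≡2t))))

  B22-col0-odd : ∀ k t (i : Fin N) → k < r → k ≡ suc (2 * t) → toℕ i ≡ k → B22 r k i zero ≡ + 1
  B22-col0-odd k t i k<r k≡2t+1 i≡k =
    trans (B22-unfold k i)
      (trans (sumMat-single r _ i zero t t<r λ s s<r s≢t →
                conjτᵐR-col0-vanishes (suc (2 * s)) k i (2s+1<N s<r) (k<N k<r)
                  (λ ()) (λ (_ , 2s+1≡k) → s≢t (ℕP.*-cancelˡ-≡ s t 2 (ℕP.suc-injective (trans 2s+1≡k k≡2t+1)))))
             (subst (λ m → iter m conjτ (R k) i zero ≡ + 1) k≡2t+1
                    (conjτᵏR-col0 k i (subst (1 ≤_) (sym k≡2t+1) (s≤s z≤n)) (k<N k<r) i≡k)))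
    where
      t<r : t < r
      t<r = ℕP.≤-<-trans (ℕP.m≤n⇒m≤1+n (ℕP.m≤m+n t (t + 0))) (subst (_< r) k≡2t+1 k<r)

  term : (ℕ → ℕ) → (ℕ → ℕ) → ℕ → Mat N
  term a b k = a k · B21 r k ⊕ b k · B22 r k

  -- lowerPart r m is, by definition, lower (λ k → m k 1) (λ k → m k 2).
  lower : (ℕ → ℕ) → (ℕ → ℕ) → Mat N
  lower a b = sumMat (r ∸ 1) (λ k′ → term a b (suc k′))

  x*0+y*0≡0 : ∀ (x y : ℤ) → x ℤ.* + 0 ℤ.+ y ℤ.* + 0 ≡ + 0
  x*0+y*0≡0 = solve-∀

  x*1+y*0≡x : ∀ (x y : ℤ) → x ℤ.* + 1 ℤ.+ y ℤ.* + 0 ≡ x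
  x*1+y*0≡x = solve-∀

  x*0+y*1≡y : ∀ (x y : ℤ) → x ℤ.* + 0 ℤ.+ y ℤ.* + 1 ≡ y
  x*0+y*1≡y = solve-∀

  term-col0 : ∀ a b k (i : Fin N) {x y} → B21 r k i zero ≡ x → B22 r k i zero ≡ y →
              term a b k i zero ≡ + a k ℤ.* x ℤ.+ + b k ℤ.* y
  term-col0 a b k i B21≡x B22≡y = cong₂ (λ x y → + a k ℤ.* x ℤ.+ + b k ℤ.* y) B21≡x B22≡y

  term-col0-vanishes : ∀ a b k (i : Fin N) → k < r → toℕ i ≢ k → toℕ i ≢ N ∸ k → term a b k i zero ≡ + 0
  term-col0-vanishes a b k i k<r i≢k i≢N∸k =
    trans (term-col0 a b k i (B21-col0-vanishes k i k<r i≢k i≢N∸k) (B22-col0-vanishes k i k<r i≢k))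
          (x*0+y*0≡0 (+ a k) (+ b k))

  1+s<r⇒s<r∸1 : ∀ {s} → suc s < r → s < r ∸ 1
  1+s<r⇒s<r∸1 1+s<r = ℕP.∸-monoˡ-< 1+s<r (s≤s z≤n)

  s<r∸1⇒1+s<r : ∀ {s} → s < r ∸ 1 → suc s < r
  s<r∸1⇒1+s<r s<r-1 = ℕP.<-≤-trans (s≤s s<r-1) (ℕP.≤-reflexive (ℕP.m+[n∸m]≡n 1≤r))

  lower-col0-vanishes : ∀ a b (i : Fin N) → (∀ k → 1 ≤ k → k < r → toℕ i ≢ k × toℕ i ≢ N ∸ k) →
                        lower a b i zero ≡ + 0
  lower-col0-vanishes a b i outside = sumMat-vanishing (r ∸ 1) _ i zero λ s s<r-1 →
    let k<r = s<r∸1⇒1+s<r s<r-1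
        (i≢k , i≢N∸k) = outside (suc s) (s≤s z≤n) k<r
    in term-col0-vanishes a b (suc s) i k<r i≢k i≢N∸k

  lower-col0-single : ∀ a b q (i : Fin N) → suc q < r → toℕ i ≡ suc q ⊎ toℕ i ≡ N ∸ suc q →
                      lower a b i zero ≡ term a b (suc q) i zero
  lower-col0-single a b q i 1+q<r row =
    sumMat-single (r ∸ 1) _ i zero q (1+s<r⇒s<r∸1 1+q<r) λ s s<r-1 s≢q →
      let 1+s<r = s<r∸1⇒1+s<r s<r-1
      in term-col0-vanishes a b (suc s) i 1+s<r
           ([ (λ i≡1+q i≡1+s → s≢q (ℕP.suc-injective (trans (sym i≡1+s) i≡1+q)))
            , (λ i≡N∸1+q i≡1+s → ℕP.<-irrefl (trans (sym i≡1+s) i≡N∸1+q) (ℕP.<-trans 1+s<r (r<N∸k 1+q<r)))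
            ] row)
           ([ (λ i≡1+q i≡N∸1+s → ℕP.<-irrefl (trans (sym i≡1+q) i≡N∸1+s) (ℕP.<-trans 1+q<r (r<N∸k 1+s<r)))
            , (λ i≡N∸1+q i≡N∸1+s → s≢q (ℕP.suc-injective
                 (ℕP.∸-cancelˡ-≡ (ℕP.<⇒≤ (k<N 1+s<r)) (ℕP.<⇒≤ (k<N 1+q<r)) (trans (sym i≡N∸1+s) i≡N∸1+q))))
            ] row)

  lower-col0-high : ∀ a b q (i : Fin N) → suc q < r → toℕ i ≡ N ∸ suc q → lower a b i zero ≡ + a (suc q)
  lower-col0-high a b q i 1+q<r i≡N∸k = begin
    lower a b i zero
      ≡⟨ lower-col0-single a b q i 1+q<r (inj₂ i≡N∸k) ⟩
    term a b (suc q) i zero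
      ≡⟨ term-col0 a b (suc q) i (B21-col0-high (suc q) i 1+q<r i≡N∸k)
                               (B22-col0-vanishes (suc q) i 1+q<r i≢k) ⟩
    + a (suc q) ℤ.* + 1 ℤ.+ + b (suc q) ℤ.* + 0
      ≡⟨ x*1+y*0≡x (+ a (suc q)) (+ b (suc q)) ⟩
    + a (suc q) ∎
    where
      open ≡-Reasoning
      i≢k : toℕ i ≢ suc q
      i≢k i≡k = ℕP.<-irrefl (trans (sym i≡k) i≡N∸k) (k<N∸k 1+q<r)

  lower-col0-even : ∀ a b q t (i : Fin N) → suc q < r → suc q ≡ 2 * t → toℕ i ≡ suc q →
                    lower a b i zero ≡ + a (suc q)
  lower-col0-even a b q t i 1+q<r k≡2t i≡k = begin
    lower a b i zero
      ≡⟨ lower-col0-single a b q i 1+q<r (inj₁ i≡k) ⟩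
    term a b (suc q) i zero
      ≡⟨ term-col0 a b (suc q) i (B21-col0-even (suc q) t i (s≤s z≤n) 1+q<r k≡2t i≡k)
                               (B22-col0-even (suc q) t i 1+q<r k≡2t) ⟩
    + a (suc q) ℤ.* + 1 ℤ.+ + b (suc q) ℤ.* + 0
      ≡⟨ x*1+y*0≡x (+ a (suc q)) (+ b (suc q)) ⟩
    + a (suc q) ∎
    where open ≡-Reasoning

  lower-col0-odd : ∀ a b q t (i : Fin N) → suc q < r → suc q ≡ suc (2 * t) → toℕ i ≡ suc q →
                   lower a b i zero ≡ + b (suc q)
  lower-col0-odd a b q t i 1+q<r k≡2t+1 i≡k = begin
    lower a b i zero
      ≡⟨ lower-col0-single a b q i 1+q<r (inj₁ i≡k) ⟩
    term a b (suc q) i zero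
      ≡⟨ term-col0 a b (suc q) i (B21-col0-odd (suc q) t i 1+q<r k≡2t+1 i≡k)
                               (B22-col0-odd (suc q) t i 1+q<r k≡2t+1 i≡k) ⟩
    + a (suc q) ℤ.* + 0 ℤ.+ + b (suc q) ℤ.* + 1
      ≡⟨ x*0+y*1≡y (+ a (suc q)) (+ b (suc q)) ⟩
    + b (suc q) ∎
    where open ≡-Reasoning

  B21-conjτ²-invariant : ∀ k → conjτ (conjτ (B21 r k)) ≐ B21 r k
  B21-conjτ²-invariant k =
    evenOrbitSum-conjτ²-invariant r (R k) (subst (λ m → iter m conjτ (R {N} k) ≐ R k) N≡2r (conjτᴺ (R k)))

  conjτ-term : ∀ a b k → conjτ (term a b k) ≐ term b a k
  conjτ-term a b k = begin
    conjτ (a k · B21 r k ⊕ b k · B22 r k)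
      ≈⟨ τ.⊕-hom (a k · B21 r k) (b k · B22 r k) ⟩
    conjτ (a k · B21 r k) ⊕ conjτ (b k · B22 r k)
      ≈⟨ ⊕-cong (τ.·-hom (a k) (B21 r k))
                (≐-trans (τ.·-hom (b k) (B22 r k)) (·-cong (b k) (B21-conjτ²-invariant k))) ⟩
    a k · B22 r k ⊕ b k · B21 r k
      ≈⟨ (λ i j → ℤP.+-comm ((a k · B22 r k) i j) ((b k · B21 r k) i j)) ⟩
    term b a k ∎
    where
      module τ = IsLinear (conjτ-linear {N})
      open ≐-Reasoning

  conjτ-lower : ∀ a b → conjτ (lower a b) ≐ lower b a
  conjτ-lower a b = ≐-trans (IsLinear.sumMat-hom conjτ-linear (r ∸ 1) _)
                            (sumMat-cong (r ∸ 1) (λ k′ _ → conjτ-term a b (suc k′)))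

  lower-swap : ∀ a b → (∀ k → 1 ≤ k → k ≤ r ∸ 1 → a k ≡ b k) → lower b a ≐ lower a b
  lower-swap a b agree = sumMat-cong (r ∸ 1) λ k′ k′<r-1 →
    let a≡b = agree (suc k′) (s≤s z≤n) k′<r-1
    in ≡⇒≐ (cong₂ (λ x y → x · B21 r (suc k′) ⊕ y · B22 r (suc k′)) (sym a≡b) a≡b)

  lower-conjτ²-invariant : ∀ a b → conjτ (conjτ (lower a b)) ≐ lower a b
  lower-conjτ²-invariant a b = ≐-trans (IsLinear.≐-resp conjτ-linear (conjτ-lower a b)) (conjτ-lower b a)

  BN-conjτ-invariant : conjτ (BN r) ≐ BN r
  BN-conjτ-invariant = orbitSum-conjτ-invariant r (R r) conjτʳR-fixed

  BN-col0-r : ∀ (i : Fin N) → toℕ i ≡ r → BN r i zero ≡ + 1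
  BN-col0-r i i≡r =
    trans (sumMat-single r _ i zero 0 1≤r λ s s<r s≢0 →
             conjτᵐR-col0-vanishes s r i (k<N s<r) r<N (λ (s≡0 , _) → s≢0 s≡0) (λ (_ , s≡r) → ℕP.<-irrefl s≡r s<r))
          (R-col0 r i (trans i≡r (sym N∸r≡r)))

  BN-col0-vanishes : ∀ (i : Fin N) → toℕ i ≢ r → BN r i zero ≡ + 0
  BN-col0-vanishes i i≢r = sumMat-vanishing r _ i zero λ s s<r →
    conjτᵐR-col0-vanishes s r i (k<N s<r) r<N
      (λ (_ , i≡N∸r) → i≢r (trans i≡N∸r N∸r≡r)) (λ (_ , s≡r) → ℕP.<-irrefl s≡r s<r)

  module EvenTop (u : ℕ) (r≡2u : r ≡ 2 * u) where

    r/2≡u : r / 2 ≡ u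
    r/2≡u = trans (cong (_/ 2) (trans r≡2u (ℕP.*-comm 2 u))) (m*n/n≡m u 2)

    2s<r : ∀ {s} → s < r / 2 → 2 * s < r
    2s<r {s} s<r/2 = subst (2 * s <_) (sym r≡2u) (ℕP.*-monoʳ-< 2 (subst (s <_) r/2≡u s<r/2))

    B21top-conjτ²-invariant : conjτ (conjτ (B21top r)) ≐ B21top r
    B21top-conjτ²-invariant = evenOrbitSum-conjτ²-invariant (r / 2) (R r)
      (subst (λ m → iter m conjτ (R {N} r) ≐ R r) (sym (trans (cong (2 *_) r/2≡u) (sym r≡2u))) conjτʳR-fixed)

    B21top-col0-r : ∀ (i : Fin N) → toℕ i ≡ r → B21top r i zero ≡ + 1
    B21top-col0-r i i≡r =
      trans (sumMat-single (r / 2) _ i zero 0 0<r/2 λ s s<r/2 s≢0 →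
               conjτᵐR-col0-vanishes (2 * s) r i (k<N (2s<r s<r/2)) r<N
                 (λ (2s≡0 , _) → s≢0 (2*s≡0⇒s≡0 2s≡0)) (λ (_ , 2s≡r) → ℕP.<-irrefl 2s≡r (2s<r s<r/2)))
            (R-col0 r i (trans i≡r (sym N∸r≡r)))
      where
        0<r/2 : 0 < r / 2
        0<r/2 = ℕP.n≢0⇒n>0 (λ r/2≡0 → ℕP.<-irrefl (sym (trans r≡2u (cong (2 *_) (trans (sym r/2≡u) r/2≡0)))) 1≤r)

    B21top-col0-vanishes : ∀ (i : Fin N) → toℕ i ≢ r → B21top r i zero ≡ + 0
    B21top-col0-vanishes i i≢r = sumMat-vanishing (r / 2) _ i zero λ s s<r/2 →
      conjτᵐR-col0-vanishes (2 * s) r i (k<N (2s<r s<r/2)) r<N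
        (λ (_ , i≡N∸r) → i≢r (trans i≡N∸r N∸r≡r)) (λ (_ , 2s≡r) → ℕP.<-irrefl 2s≡r (2s<r s<r/2))

    B22top-col0-vanishes : ∀ (i : Fin N) → B22top r i zero ≡ + 0
    B22top-col0-vanishes i =
      trans (IsLinear.sumMat-hom conjτ-linear (r / 2) (λ s → iter (2 * s) conjτ (R r)) i zero)
            (sumMat-vanishing (r / 2) _ i zero λ s s<r/2 →
               conjτᵐR-col0-vanishes (suc (2 * s)) r i (ℕP.≤-<-trans (2s<r s<r/2) r<N) r<N
                 (λ ()) (λ (_ , 2s+1≡r) → ℕP.even≢odd u s (sym (trans 2s+1≡r r≡2u))))

module Coefficients {n : ℕ} (B : Mat (suc (suc n))) (skew : SkewSym B) (sinkType : Period2SinkType B) where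
  open Rotation n
  open Period2Sink B skew sinkType

  B-col0-nonneg : ∀ i → + 0 ℤ.≤ B i zero
  B-col0-nonneg i = subst (+ 0 ℤ.≤_) (sym (skew i zero)) (ℤP.neg-mono-≤ (sink₁ i))

  conjτB-cycPred-col0 : ∀ i → conjτ B (cycPred i) zero ≡ sgn i ℤ.* B i node2
  conjτB-cycPred-col0 i = begin
    conjτ B (cycPred i) zero
      ≡⟨ cancel (sgn i) (conjτ B (cycPred i) zero) (sgn² i) ⟨
    sgn i ℤ.* (sgn i ℤ.* + 1 ℤ.* conjτ B (cycPred i) zero)
      ≡⟨ cong (sgn i ℤ.*_) (conjτ²-invariant i node2) ⟩
    sgn i ℤ.* B i node2 ∎
    where
      open ≡-Reasoning
      cancel : ∀ (s x : ℤ) → s ℤ.* s ≡ + 1 → s ℤ.* (s ℤ.* + 1 ℤ.* x) ≡ x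
      cancel s x s²≡1 = trans (regroup s x) (trans (cong (ℤ._* x) s²≡1) (ℤP.*-identityˡ x))
        where
          regroup : ∀ (s x : ℤ) → s ℤ.* (s ℤ.* + 1 ℤ.* x) ≡ s ℤ.* s ℤ.* x
          regroup = solve-∀

  -- Column 0 of τBτ⁻¹ is column 1 of B shifted up by one, which is nonnegative because
  -- node 2 is a sink of μ₁B, except for b_{12} ≤ 0, which enters with a minus sign.
  conjτB-col0-nonneg : ∀ i → + 0 ℤ.≤ conjτ B i zero
  conjτB-col0-nonneg i = subst (λ x → + 0 ℤ.≤ conjτ B x zero) (cycPredᴺ i) (nonneg (cycPredⁿ (suc n) i))
    where
      nonneg : ∀ x → + 0 ℤ.≤ conjτ B (cycPred x) zero
      nonneg zero =
        subst (+ 0 ℤ.≤_) (sym (trans (conjτB-cycPred-col0 zero) (ℤP.-1*i≡-i (B zero node2))))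
              (ℤP.neg-mono-≤ (sink₁ node2))
      nonneg (suc x) =
        subst (+ 0 ℤ.≤_) (sym (trans (conjτB-cycPred-col0 (suc x)) (trans (ℤP.*-identityˡ _) (skew (suc x) node2))))
              (ℤP.neg-mono-≤ (subst (ℤ._≤ + 0) (trans (μ₁-sign node2 (suc x)) (ℤP.*-identityˡ _)) (sink₂ (suc x))))

  -- node N-k+1, for 1 ≤ k ≤ N
  row : ℕ → Fin N
  row k = (N ∸ k) mod N

  toℕ-row : ∀ k → 1 ≤ k → toℕ (row k) ≡ N ∸ k
  toℕ-row (suc k) _ = trans (FinP.toℕ-fromℕ< _) (m<n⇒m%n≡m (s≤s (ℕP.m∸n≤m (suc n) k)))

  -- coeff k 1 = b_{N-k+1,1} and coeff k 2 = (τBτ⁻¹)_{N-k+1,1}; no other j is used.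
  coeff : ℕ → ℕ → ℕ
  coeff k 2 = ℤ.∣ conjτ B (row k) zero ∣
  coeff k _ = ℤ.∣ B (row k) zero ∣

  B-col0-high : ∀ k (i : Fin N) → 1 ≤ k → toℕ i ≡ N ∸ k → B i zero ≡ + coeff k 1
  B-col0-high k i 1≤k i≡N∸k =
    trans (cong (λ x → B x zero) (FinP.toℕ-injective (trans i≡N∸k (sym (toℕ-row k 1≤k)))))
          (sym (ℤP.0≤i⇒+∣i∣≡i (B-col0-nonneg (row k))))

  conjτB-col0-high : ∀ k (i : Fin N) → 1 ≤ k → toℕ i ≡ N ∸ k → conjτ B i zero ≡ + coeff k 2
  conjτB-col0-high k i 1≤k i≡N∸k =
    trans (cong (λ x → conjτ B x zero) (FinP.toℕ-injective (trans i≡N∸k (sym (toℕ-row k 1≤k)))))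
          (sym (ℤP.0≤i⇒+∣i∣≡i (conjτB-col0-nonneg (row k))))

  conjτB-conjτ²-invariant : conjτ (conjτ (conjτ B)) ≐ conjτ B
  conjτB-conjτ²-invariant = IsLinear.≐-resp conjτ-linear conjτ²-invariant

  col0-via-conjτᵏ : ∀ k (A A′ : Mat N) → SkewSym A′ → iter k conjτ A′ ≐ A → 1 ≤ k → k < N →
                    ∀ (i : Fin N) → toℕ i ≡ k → A i zero ≡ A′ (row k) zero
  col0-via-conjτᵏ k A A′ skew′ carries 1≤k k<N i i≡k =
    trans (sym (carries i zero)) (conjτᵏ-col0 k A′ skew′ 1≤k k<N i (row k) i≡k (toℕ-row k 1≤k))

  -- Both B and τBτ⁻¹ are τ²-invariant, so τᵏ carries B to B (k even) or τBτ⁻¹ to B (k odd),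
  -- and likewise for τBτ⁻¹: rows k < r of the first columns repeat rows N-k, possibly swapped.
  B-col0-even : ∀ k t (i : Fin N) → 1 ≤ k → k < N → k ≡ 2 * t → toℕ i ≡ k → B i zero ≡ + coeff k 1
  B-col0-even k t i 1≤k k<N k≡2t i≡k =
    trans (col0-via-conjτᵏ k B B skew
             (subst (λ m → iter m conjτ B ≐ B) (sym k≡2t) (conjτ²-fixed⇒even-fixed conjτ²-invariant t))
             1≤k k<N i i≡k)
          (B-col0-high k (row k) 1≤k (toℕ-row k 1≤k))

  conjτB-col0-even : ∀ k t (i : Fin N) → 1 ≤ k → k < N → k ≡ 2 * t → toℕ i ≡ k → conjτ B i zero ≡ + coeff k 2
  conjτB-col0-even k t i 1≤k k<N k≡2t i≡k =
    trans (col0-via-conjτᵏ k (conjτ B) (conjτ B) (conjτ-skew skew)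
             (subst (λ m → iter m conjτ (conjτ B) ≐ conjτ B) (sym k≡2t)
                    (conjτ²-fixed⇒even-fixed conjτB-conjτ²-invariant t))
             1≤k k<N i i≡k)
          (conjτB-col0-high k (row k) 1≤k (toℕ-row k 1≤k))

  B-col0-odd : ∀ k t (i : Fin N) → k < N → k ≡ suc (2 * t) → toℕ i ≡ k → B i zero ≡ + coeff k 2
  B-col0-odd k t i k<N k≡2t+1 i≡k =
    trans (col0-via-conjτᵏ k B (conjτ B) (conjτ-skew skew)
             (subst (λ m → iter m conjτ (conjτ B) ≐ B) (sym k≡2t+1)
                    (≐-trans (IsLinear.≐-resp conjτ-linear (conjτ²-fixed⇒even-fixed conjτB-conjτ²-invariant t))
                             conjτ²-invariant))
             1≤k k<N i i≡k)
          (conjτB-col0-high k (row k) 1≤k (toℕ-row k 1≤k))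
    where
      1≤k : 1 ≤ k
      1≤k = subst (1 ≤_) (sym k≡2t+1) (s≤s z≤n)

  conjτB-col0-odd : ∀ k t (i : Fin N) → k < N → k ≡ suc (2 * t) → toℕ i ≡ k → conjτ B i zero ≡ + coeff k 1
  conjτB-col0-odd k t i k<N k≡2t+1 i≡k =
    trans (col0-via-conjτᵏ k (conjτ B) B skew
             (subst (λ m → iter m conjτ B ≐ conjτ B) (sym k≡2t+1)
                    (IsLinear.≐-resp conjτ-linear (conjτ²-fixed⇒even-fixed conjτ²-invariant t)))
             1≤k k<N i i≡k)
          (B-col0-high k (row k) 1≤k (toℕ-row k 1≤k))
    where
      1≤k : 1 ≤ k
      1≤k = subst (1 ≤_) (sym k≡2t+1) (s≤s z≤n)

  B-col0-zero : ∀ (i : Fin N) → toℕ i ≡ 0 → B i zero ≡ + 0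
  B-col0-zero i i≡0 rewrite FinP.toℕ-injective {i = i} {j = zero} i≡0 = i≡-i⇒i≡0 (skew zero zero)

  conjτB-col0-zero : ∀ (i : Fin N) → toℕ i ≡ 0 → conjτ B i zero ≡ + 0
  conjτB-col0-zero i i≡0 rewrite FinP.toℕ-injective {i = i} {j = zero} i≡0 = i≡-i⇒i≡0 (conjτ-skew skew zero zero)

-- The even case

differ-or-agree : ∀ (f g : ℕ → ℕ) K → (∃[ k ] (1 ≤ k × k ≤ K × f k ≢ g k)) ⊎ (∀ k → 1 ≤ k → k ≤ K → f k ≡ g k)
differ-or-agree f g zero = inj₂ (λ k 1≤k k≤0 → ⊥-elim (ℕP.<⇒≱ 1≤k k≤0))
differ-or-agree f g (suc K) with differ-or-agree f g K | f (suc K) ≟ g (suc K)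
... | inj₁ (k , 1≤k , k≤K , differ) | _ = inj₁ (k , 1≤k , ℕP.m≤n⇒m≤1+n k≤K , differ)
... | inj₂ _     | no differ = inj₁ (suc K , s≤s z≤n , ℕP.≤-refl , differ)
... | inj₂ agree | yes agreeᴷ = inj₂ agree′
  where
    agree′ : ∀ k → 1 ≤ k → k ≤ suc K → f k ≡ g k
    agree′ k 1≤k k≤1+K with ℕP.m≤n⇒m<n∨m≡n k≤1+K
    ... | inj₁ k<1+K = agree k 1≤k (ℕP.≤-pred k<1+K)
    ... | inj₂ refl  = agreeᴷ

4∣2r⇒r-even : ∀ {r} → 4 ∣ 2 * r → ∃[ u ] r ≡ 2 * u
4∣2r⇒r-even {r} (divides q 2r≡q*4) =
  q , ℕP.*-cancelˡ-≡ r (2 * q) 2 (trans 2r≡q*4 (trans (ℕP.*-comm q 4) (ℕP.*-assoc 2 2 q)))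

¬4∣2r⇒r-odd : ∀ {r} → ¬ 4 ∣ 2 * r → ∃[ u ] r ≡ suc (2 * u)
¬4∣2r⇒r-odd {r} ¬4∣2r with even-or-odd r
... | u , inj₂ r≡2u+1 = u , r≡2u+1
... | u , inj₁ r≡2u   =
  ⊥-elim (¬4∣2r (divides u (trans (cong (2 *_) r≡2u) (sym (trans (ℕP.*-comm u 4) (ℕP.*-assoc 2 2 u))))))

module EvenCase (n r : ℕ) (N≡2r : suc (suc n) ≡ 2 * r)
                (B : Mat (suc (suc n))) (skew : SkewSym B) (sinkType : Period2SinkType B) where
  open Rotation n
  open Basis n r N≡2r
  open Period2Sink B skew sinkType
  open Coefficients B skew sinkType

  coeff₁ coeff₂ : ℕ → ℕ
  coeff₁ k = coeff k 1
  coeff₂ k = coeff k 2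

  rowCases : (P : Fin N → Set) →
             (∀ i → toℕ i ≡ 0 → P i) →
             (∀ i → toℕ i ≡ r → P i) →
             (∀ q i → suc q < r → toℕ i ≡ suc q → P i) →
             (∀ q i → suc q < r → toℕ i ≡ N ∸ suc q → P i) →
             ∀ i → P i
  rowCases P at0 atr low high i with ℕP.<-cmp (toℕ i) r
  ... | tri≈ _ i≡r _ = atr i i≡r
  ... | tri> _ _ r<i = high (suc n ∸ toℕ i) i k<r (sym (ℕP.m∸[m∸n]≡n i≤1+n))
    where
      i≤1+n : toℕ i ≤ suc n
      i≤1+n = ℕP.≤-pred (FinP.toℕ<n i)
      k<r : suc (suc n ∸ toℕ i) < r
      k<r = subst₂ _<_ (ℕP.+-∸-assoc 1 i≤1+n) N∸r≡r (ℕP.∸-monoʳ-< r<i (ℕP.<⇒≤ (FinP.toℕ<n i)))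
  ... | tri< i<r _ _ with toℕ i in i≡
  ...   | zero  = at0 i i≡
  ...   | suc q = low q i i<r i≡

  lower-col0-r : ∀ a b (i : Fin N) → toℕ i ≡ r → lower a b i zero ≡ + 0
  lower-col0-r a b i i≡r = lower-col0-vanishes a b i λ k _ k<r →
    (λ i≡k → ℕP.<-irrefl (trans (sym i≡k) i≡r) k<r) ,
    (λ i≡N∸k → ℕP.<-irrefl (trans (sym i≡r) i≡N∸k) (r<N∸k k<r))

  lower-col0-zero : ∀ a b (i : Fin N) → toℕ i ≡ 0 → lower a b i zero ≡ + 0
  lower-col0-zero a b i i≡0 = lower-col0-vanishes a b i λ k 1≤k k<r →
    (λ i≡k → ℕP.<-irrefl (trans (sym i≡0) i≡k) 1≤k) ,
    (λ i≡N∸k → ℕP.<-irrefl (trans (sym i≡0) i≡N∸k) (ℕP.≤-<-trans z≤n (r<N∸k k<r)))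

  lower-col0≡B-col0 : ∀ i → toℕ i ≢ r → lower coeff₁ coeff₂ i zero ≡ B i zero
  lower-col0≡B-col0 = rowCases (λ i → toℕ i ≢ r → lower coeff₁ coeff₂ i zero ≡ B i zero)
    (λ i i≡0 _ → trans (lower-col0-zero coeff₁ coeff₂ i i≡0) (sym (B-col0-zero i i≡0)))
    (λ i i≡r i≢r → ⊥-elim (i≢r i≡r))
    (λ q i 1+q<r i≡k _ → lower-even-odd q i 1+q<r i≡k)
    (λ q i 1+q<r i≡N∸k _ → trans (lower-col0-high coeff₁ coeff₂ q i 1+q<r i≡N∸k)
                                 (sym (B-col0-high (suc q) i (s≤s z≤n) i≡N∸k)))
    where
      lower-even-odd : ∀ q i → suc q < r → toℕ i ≡ suc q → lower coeff₁ coeff₂ i zero ≡ B i zero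
      lower-even-odd q i 1+q<r i≡k with even-or-odd (suc q)
      ... | t , inj₁ k≡2t   = trans (lower-col0-even coeff₁ coeff₂ q t i 1+q<r k≡2t i≡k)
                                    (sym (B-col0-even (suc q) t i (s≤s z≤n) (k<N 1+q<r) k≡2t i≡k))
      ... | t , inj₂ k≡2t+1 = trans (lower-col0-odd coeff₁ coeff₂ q t i 1+q<r k≡2t+1 i≡k)
                                    (sym (B-col0-odd (suc q) t i (k<N 1+q<r) k≡2t+1 i≡k))

  lower-col0≡conjτB-col0 : ∀ i → toℕ i ≢ r → lower coeff₂ coeff₁ i zero ≡ conjτ B i zero
  lower-col0≡conjτB-col0 = rowCases (λ i → toℕ i ≢ r → lower coeff₂ coeff₁ i zero ≡ conjτ B i zero)
    (λ i i≡0 _ → trans (lower-col0-zero coeff₂ coeff₁ i i≡0) (sym (conjτB-col0-zero i i≡0)))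
    (λ i i≡r i≢r → ⊥-elim (i≢r i≡r))
    (λ q i 1+q<r i≡k _ → lower-even-odd q i 1+q<r i≡k)
    (λ q i 1+q<r i≡N∸k _ → trans (lower-col0-high coeff₂ coeff₁ q i 1+q<r i≡N∸k)
                                 (sym (conjτB-col0-high (suc q) i (s≤s z≤n) i≡N∸k)))
    where
      lower-even-odd : ∀ q i → suc q < r → toℕ i ≡ suc q → lower coeff₂ coeff₁ i zero ≡ conjτ B i zero
      lower-even-odd q i 1+q<r i≡k with even-or-odd (suc q)
      ... | t , inj₁ k≡2t   = trans (lower-col0-even coeff₂ coeff₁ q t i 1+q<r k≡2t i≡k)
                                    (sym (conjτB-col0-even (suc q) t i (s≤s z≤n) (k<N 1+q<r) k≡2t i≡k))
      ... | t , inj₂ k≡2t+1 = trans (lower-col0-odd coeff₂ coeff₁ q t i 1+q<r k≡2t+1 i≡k)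
                                    (sym (conjτB-col0-odd (suc q) t i (k<N 1+q<r) k≡2t+1 i≡k))

  module τ = IsLinear (conjτ-linear {N})
  module τ² = IsLinear (conjτ²-linear {N})

  col0-split : ∀ (X L T : Mat N) →
               (∀ i → toℕ i ≡ r → L i zero ≡ + 0 × T i zero ≡ X i zero) →
               (∀ i → toℕ i ≢ r → L i zero ≡ X i zero × T i zero ≡ + 0) →
               ∀ i → X i zero ≡ (L ⊕ T) i zero
  col0-split X L T at-r off-r i with toℕ i ≟ r
  ... | yes i≡r = let (L≡0 , T≡X) = at-r i i≡r in sym (trans (cong₂ ℤ._+_ L≡0 T≡X) (ℤP.+-identityˡ _))
  ... | no  i≢r = let (L≡X , T≡0) = off-r i i≢r in sym (trans (cong₂ ℤ._+_ L≡X T≡0) (ℤP.+-identityʳ _))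

  decomposition : ∀ (Top : Mat N) → conjτ (conjτ Top) ≐ Top →
                  (∀ i → toℕ i ≡ r → Top i zero ≡ B i zero × conjτ Top i zero ≡ conjτ B i zero) →
                  (∀ i → toℕ i ≢ r → Top i zero ≡ + 0 × conjτ Top i zero ≡ + 0) →
                  B ≐ (lower coeff₁ coeff₂ ⊕ Top)
  decomposition Top Top-invariant at-r off-r =
    τ²-invariant-unique conjτ²-invariant
      (≐-trans (τ².⊕-hom (lower coeff₁ coeff₂) Top) (⊕-cong (lower-conjτ²-invariant coeff₁ coeff₂) Top-invariant))
      (col0-split B (lower coeff₁ coeff₂) Top
        (λ i i≡r → lower-col0-r coeff₁ coeff₂ i i≡r , proj₁ (at-r i i≡r))
        (λ i i≢r → lower-col0≡B-col0 i i≢r , proj₁ (off-r i i≢r)))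
      (λ i → trans (col0-split (conjτ B) (lower coeff₂ coeff₁) (conjτ Top)
                      (λ i i≡r → lower-col0-r coeff₂ coeff₁ i i≡r , proj₂ (at-r i i≡r))
                      (λ i i≢r → lower-col0≡conjτB-col0 i i≢r , proj₂ (off-r i i≢r)) i)
                   (sym (≐-trans (τ.⊕-hom (lower coeff₁ coeff₂) Top)
                                 (⊕-cong (conjτ-lower coeff₁ coeff₂) ≐-refl) i zero)))

  conjτ-invariant-if-coeffs-agree : ∀ Top → B ≐ (lower coeff₁ coeff₂ ⊕ Top) → conjτ Top ≐ Top →
                                    (∀ k → 1 ≤ k → k ≤ r ∸ 1 → coeff₁ k ≡ coeff₂ k) → conjτ B ≐ B
  conjτ-invariant-if-coeffs-agree Top B≐ Top-fixed agree = begin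
    conjτ B
      ≈⟨ τ.≐-resp B≐ ⟩
    conjτ (lower coeff₁ coeff₂ ⊕ Top)
      ≈⟨ τ.⊕-hom (lower coeff₁ coeff₂) Top ⟩
    conjτ (lower coeff₁ coeff₂) ⊕ conjτ Top
      ≈⟨ ⊕-cong (≐-trans (conjτ-lower coeff₁ coeff₂) (lower-swap coeff₁ coeff₂ agree)) Top-fixed ⟩
    lower coeff₁ coeff₂ ⊕ Top
      ≈⟨ ≐-sym B≐ ⟩
    B ∎
    where open ≐-Reasoning

  module FourDivides (u : ℕ) (r≡2u : r ≡ 2 * u) where
    open EvenTop u r≡2u

    c₁ c₂ : ℕ
    c₁ = coeff r 1
    c₂ = coeff r 2

    top : Mat N
    top = c₁ · B21top r ⊕ c₂ · B22top r

    B22top-conjτ²-invariant : conjτ (conjτ (B22top r)) ≐ B22top r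
    B22top-conjτ²-invariant = τ.≐-resp B21top-conjτ²-invariant

    conjτ-top : conjτ top ≐ (c₁ · B22top r ⊕ c₂ · B21top r)
    conjτ-top = ≐-trans (τ.⊕-hom (c₁ · B21top r) (c₂ · B22top r))
                        (⊕-cong (τ.·-hom c₁ (B21top r))
                                (≐-trans (τ.·-hom c₂ (B22top r)) (·-cong c₂ B21top-conjτ²-invariant)))

    top-conjτ²-invariant : conjτ (conjτ top) ≐ top
    top-conjτ²-invariant =
      ≐-trans (τ².⊕-hom (c₁ · B21top r) (c₂ · B22top r))
              (⊕-cong (≐-trans (τ².·-hom c₁ (B21top r)) (·-cong c₁ B21top-conjτ²-invariant))
                      (≐-trans (τ².·-hom c₂ (B22top r)) (·-cong c₂ B22top-conjτ²-invariant)))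

    top-conjτ-invariant : c₁ ≡ c₂ → conjτ top ≐ top
    top-conjτ-invariant c₁≡c₂ i j =
      trans (conjτ-top i j)
            (trans (ℤP.+-comm ((c₁ · B22top r) i j) ((c₂ · B21top r) i j))
                   (cong₂ (λ x y → (x · B21top r ⊕ y · B22top r) i j) (sym c₁≡c₂) c₁≡c₂))

    top-col0 : ∀ i {x y} → B21top r i zero ≡ x → B22top r i zero ≡ y → top i zero ≡ + c₁ ℤ.* x ℤ.+ + c₂ ℤ.* y
    top-col0 i = cong₂ (λ x y → + c₁ ℤ.* x ℤ.+ + c₂ ℤ.* y)

    conjτtop-col0 : ∀ i {x y} → B22top r i zero ≡ x → B21top r i zero ≡ y →
                    conjτ top i zero ≡ + c₁ ℤ.* x ℤ.+ + c₂ ℤ.* y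
    conjτtop-col0 i B22≡x B21≡y = trans (conjτ-top i zero) (cong₂ (λ x y → + c₁ ℤ.* x ℤ.+ + c₂ ℤ.* y) B22≡x B21≡y)

    B≐lower⊕top : B ≐ (lower coeff₁ coeff₂ ⊕ top)
    B≐lower⊕top = decomposition top top-conjτ²-invariant at-r off-r
      where
        at-r : ∀ i → toℕ i ≡ r → top i zero ≡ B i zero × conjτ top i zero ≡ conjτ B i zero
        at-r i i≡r =
          trans (top-col0 i (B21top-col0-r i i≡r) (B22top-col0-vanishes i))
                (trans (x*1+y*0≡x (+ c₁) (+ c₂)) (sym (B-col0-high r i 1≤r i≡N∸r))) ,
          trans (conjτtop-col0 i (B22top-col0-vanishes i) (B21top-col0-r i i≡r))
                (trans (x*0+y*1≡y (+ c₁) (+ c₂)) (sym (conjτB-col0-high r i 1≤r i≡N∸r)))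
          where
            i≡N∸r : toℕ i ≡ N ∸ r
            i≡N∸r = trans i≡r (sym N∸r≡r)
        off-r : ∀ i → toℕ i ≢ r → top i zero ≡ + 0 × conjτ top i zero ≡ + 0
        off-r i i≢r =
          trans (top-col0 i (B21top-col0-vanishes i i≢r) (B22top-col0-vanishes i)) (x*0+y*0≡0 (+ c₁) (+ c₂)) ,
          trans (conjτtop-col0 i (B22top-col0-vanishes i) (B21top-col0-vanishes i i≢r)) (x*0+y*0≡0 (+ c₁) (+ c₂))

    classification : ¬ Period1 B →
      ∃[ m ] ((B ≐ (lowerPart r m ⊕ m r 1 · B21top r ⊕ m r 2 · B22top r)) × ∃[ k ] (1 ≤ k × k ≤ r × m k 1 ≢ m k 2))
    classification notPeriod1 = coeff , ≐-trans B≐lower⊕top reassociate , witness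
      where
        reassociate : (lower coeff₁ coeff₂ ⊕ top) ≐ (lower coeff₁ coeff₂ ⊕ c₁ · B21top r ⊕ c₂ · B22top r)
        reassociate i j = sym (ℤP.+-assoc (lower coeff₁ coeff₂ i j) ((c₁ · B21top r) i j) ((c₂ · B22top r) i j))
        witness : ∃[ k ] (1 ≤ k × k ≤ r × coeff k 1 ≢ coeff k 2)
        witness with differ-or-agree coeff₁ coeff₂ r
        ... | inj₁ differ = differ
        ... | inj₂ agree  = ⊥-elim (notPeriod1 (conjτ-invariant⇒period1
                (conjτ-invariant-if-coeffs-agree top B≐lower⊕top (top-conjτ-invariant (agree r 1≤r ℕP.≤-refl))
                   (λ k 1≤k k≤r-1 → agree k 1≤k (ℕP.≤-trans k≤r-1 (ℕP.m∸n≤m r 1))))))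

  module FourNotDivides (u : ℕ) (r≡2u+1 : r ≡ suc (2 * u)) where

    top : Mat N
    top = coeff r 1 · BN r

    top-conjτ-invariant : conjτ top ≐ top
    top-conjτ-invariant = ≐-trans (τ.·-hom (coeff r 1) (BN r)) (·-cong (coeff r 1) BN-conjτ-invariant)

    B≐lower⊕top : B ≐ (lower coeff₁ coeff₂ ⊕ top)
    B≐lower⊕top = decomposition top (≐-trans (τ.≐-resp top-conjτ-invariant) top-conjτ-invariant) at-r off-r
      where
        top-at-r : ∀ i → toℕ i ≡ r → top i zero ≡ + coeff r 1
        top-at-r i i≡r = trans (cong (+ coeff r 1 ℤ.*_) (BN-col0-r i i≡r)) (ℤP.*-identityʳ (+ coeff r 1))
        at-r : ∀ i → toℕ i ≡ r → top i zero ≡ B i zero × conjτ top i zero ≡ conjτ B i zero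
        at-r i i≡r =
          trans (top-at-r i i≡r) (sym (B-col0-high r i 1≤r (trans i≡r (sym N∸r≡r)))) ,
          trans (top-conjτ-invariant i zero) (trans (top-at-r i i≡r) (sym (conjτB-col0-odd r u i r<N r≡2u+1 i≡r)))
        top-off-r : ∀ i → toℕ i ≢ r → top i zero ≡ + 0
        top-off-r i i≢r = trans (cong (+ coeff r 1 ℤ.*_) (BN-col0-vanishes i i≢r)) (ℤP.*-zeroʳ (+ coeff r 1))
        off-r : ∀ i → toℕ i ≢ r → top i zero ≡ + 0 × conjτ top i zero ≡ + 0
        off-r i i≢r = top-off-r i i≢r , trans (top-conjτ-invariant i zero) (top-off-r i i≢r)

    classification : ¬ Period1 B →
      ∃[ m ] ((B ≐ (lowerPart r m ⊕ m r 1 · BN r)) × ∃[ k ] (1 ≤ k × k ≤ r ∸ 1 × m k 1 ≢ m k 2))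
    classification notPeriod1 = coeff , B≐lower⊕top , witness
      where
        witness : ∃[ k ] (1 ≤ k × k ≤ r ∸ 1 × coeff k 1 ≢ coeff k 2)
        witness with differ-or-agree coeff₁ coeff₂ (r ∸ 1)
        ... | inj₁ differ = differ
        ... | inj₂ agree  = ⊥-elim (notPeriod1 (conjτ-invariant⇒period1
                (conjτ-invariant-if-coeffs-agree top B≐lower⊕top top-conjτ-invariant agree)))

  classification : ¬ Period1 B →
    (4 ∣ N → ∃[ m ] ((B ≐ (lowerPart r m ⊕ m r 1 · B21top r ⊕ m r 2 · B22top r))
                     × ∃[ k ] (1 ≤ k × k ≤ r × m k 1 ≢ m k 2)))
    ×
    (¬ 4 ∣ N → ∃[ m ] ((B ≐ (lowerPart r m ⊕ m r 1 · BN r))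
                       × ∃[ k ] (1 ≤ k × k ≤ r ∸ 1 × m k 1 ≢ m k 2)))
  classification notPeriod1 =
    (λ 4∣N → let u , r≡2u = 4∣2r⇒r-even (subst (4 ∣_) N≡2r 4∣N)
             in FourDivides.classification u r≡2u notPeriod1) ,
    (λ ¬4∣N → let u , r≡2u+1 = ¬4∣2r⇒r-odd (λ 4∣2r → ¬4∣N (subst (4 ∣_) (sym N≡2r) 4∣2r))
              in FourNotDivides.classification u r≡2u+1 notPeriod1)

mainTheorem6 :
  ((n r : ℕ) → suc (suc n) ≡ suc (2 * r) →
    (B : Mat (suc (suc n))) → SkewSym B →
    StrictlyPeriod2 B → Period2SinkType B → ⊥)
  ×
  ((n r : ℕ) → suc (suc n) ≡ 2 * r →
    (B : Mat (suc (suc n))) → SkewSym B →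
    StrictlyPeriod2 B → Period2SinkType B →
      (4 ∣ suc (suc n) →
        ∃[ m ] ((B ≐ (lowerPart r m ⊕ m r 1 · B21top r ⊕ m r 2 · B22top r))
                × ∃[ k ] (1 ≤ k × k ≤ r × m k 1 ≢ m k 2)))
      ×
      (¬ (4 ∣ suc (suc n)) →
        ∃[ m ] ((B ≐ (lowerPart r m ⊕ m r 1 · BN r))
                × ∃[ k ] (1 ≤ k × k ≤ r ∸ 1 × m k 1 ≢ m k 2))))
mainTheorem6 = no-odd-strictlyPeriod2SinkType , λ n r N≡2r B skew (_ , notPeriod1) sinkType →
  EvenCase.classification n r N≡2r B skew sinkType notPeriod1
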